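{- Let $p$ be a prime and $a,b$ integers. Let $\mathbf{C}=\begin{bmatrix}1&a\\ b&1+ab\end{bmatrix}$ and, for $k\ge1$, consider the Cat map $(x,y)^\intercal\mapsto\mathbf{C}(x,y)^\intercal\bmod p^k$ on $\mathbb{Z}_{p^k}^2$. Let $N_{T,k}$ denote the number of cycles of length $T$ in its functional graph on $\mathbb{Z}_{p^k}^2$. Then for every positive integer $T_{\rm c}$ with $\nu(T_{\rm c})>p$ and every $k\ge1$, \[ p\cdot N_{T_{\rm c},k}=N_{p\cdot T_{\rm c},k+1}. \]
   Context: $\mathbb{Z}_{p^k}$ is the ring of integers modulo $p^k$; $\nu(x)$ is the exponent of the highest power of $p$ dividing the integer $x$. The Cat map is a permutation of $\mathbb{Z}_{p^k}^2$ since $\det\mathbf{C}=1$, so its functional graph is a disjoint union of cycles. -}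

module Defs where

open import Data.Nat using (ℕ; zero; suc; _+_; _*_; _^_; _%_; _≤ᵇ_; _≡ᵇ_; NonZero)
open import Data.Nat.Properties using (m^n≢0)
open import Data.Nat.Divisibility using (_∣_)
open import Data.Integer using (ℤ)
open import Data.Integer.DivMod using (_%ℕ_)
open import Data.Bool using (Bool; true; false; _∧_; not)
open import Data.Product using (_×_; _,_)
open import Data.List using (List; []; _∷_; upTo; length; filterᵇ; concatMap; map)
open import Relation.Nullary using (¬_)

-- Points of ℤ_m², represented by pairs of canonical residues (u , v), 0 ≤ u,v < m.
Pt : Set
Pt = ℕ × ℕ

catMap : (m : ℕ) .{{_ : NonZero m}} → ℤ → ℤ → Pt → Pt
catMap m a b (x , y) =
  let a' = a %ℕ m
      b' = b %ℕ m
  in ((x + a' * y) % m , (b' * x + (1 + a' * b') * y) % m)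

iter : (Pt → Pt) → ℕ → Pt → Pt
iter f zero    x = x
iter f (suc n) x = f (iter f n x)

ptEq : Pt → Pt → Bool
ptEq (x , y) (u , v) = (x ≡ᵇ u) ∧ (y ≡ᵇ v)

allBelow : ℕ → (ℕ → Bool) → Bool
allBelow zero    P = true
allBelow (suc n) P = allBelow n P ∧ P n

points : ℕ → List Pt
points m = concatMap (λ x → map (λ y → (x , y)) (upTo m)) (upTo m)

code : ℕ → Pt → ℕ
code m (x , y) = x * m + y

onCycleOfLength : (Pt → Pt) → ℕ → Pt → Bool
onCycleOfLength f zero    x = false
onCycleOfLength f (suc t) x =
  ptEq (iter f (suc t) x) x ∧ allBelow t (λ i → not (ptEq (iter f (suc i) x) x))

isCycleRep : ℕ → (Pt → Pt) → ℕ → Pt → Bool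
isCycleRep m f T x =
  onCycleOfLength f T x ∧ allBelow T (λ i → code m x ≤ᵇ code m (iter f i x))

-- N_{T,k}: number of cycles of length T in the functional graph of the Cat map on
-- ℤ_{p^k}², counted as the number of cycles (one canonical representative per cycle).
N : (p : ℕ) .{{_ : NonZero p}} → ℤ → ℤ → (T k : ℕ) → ℕ
N p a b T k =
  length (filterᵇ (isCycleRep m (catMap m {{m^n≢0 p k}} a b) T) (points m))
  where m = p ^ k

IsValuation : ℕ → ℕ → ℕ → Set
IsValuation p T e = (p ^ e ∣ T) × ¬ (p ^ suc e ∣ T)

module Submission where

-- Write Tc = p·B with B = pᵖ·s.  For G ∈ SL₂(ℤ), Cayley–Hamilton gives (G − I)² = (tr G − 2)·G, and the
-- Frobenius congruence G^(pᵉ) ≡ I + (G − I)^(pᵉ) (mod p) shows that a primitive vector u with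
-- G^(pᵉ)u ≡ u (mod p) forces p ∣ tr G − 2, hence (G − I)² ≡ 0 and Gᵖ ≡ I (mod p).  For G = Cˢ this turns
-- any primitive point of period Tc or p·Tc modulo a power of p into C^(ps) ≡ I (mod p), so C^B ≡ I (mod p²).
-- If A ≡ I (mod q₁) and q₂ ∣ Az − z then Aᵐz − z ≡ m·(Az − z) (mod q₁q₂); with A = C^Tc this shows that a
-- point has exact period Tc modulo pᵏ iff it has exact period p·Tc modulo pᵏ⁺¹ (a non-primitive point pʲ·u
-- behaves like u modulo pᵏ⁻ʲ).  Reduction ℤ²_{pᵏ⁺¹} → ℤ²_{pᵏ} is p²-to-one, so p·Tc-cycles modulo pᵏ⁺¹
-- carry p² times as many points as Tc-cycles modulo pᵏ; dividing by the cycle lengths gives the theorem.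

open import Data.Bool using (Bool; true; false; not) renaming (T to IsTrue)
open import Data.Bool.Properties using (T-∧; T?)
open import Data.Empty using (⊥-elim)
open import Data.List using (List; []; _∷_; length; filterᵇ; map; concatMap; upTo; applyUpTo)
open import Data.List.Properties using (map-++; map-∘)
open import Data.Nat.DivMod
  using (_%_; _/_; m*[n/m]≡n; m≡m%n+[m/n]*n; m%n<n; m<n⇒m%n≡m; [m+n]%n≡m%n; [m+kn]%n≡m%n)
open import Data.Nat.ListAction using (sum)
open import Data.Nat.ListAction.Properties using (sum-++)
open import Data.Nat.Primality using (Prime; euclidsLemma; prime⇒nonTrivial; prime⇒nonZero)
open import Data.Product using (∃; ∃₂; _×_; _,_; proj₁; proj₂)
open import Data.Sum using (_⊎_; inj₁; inj₂)
open import Function using (_∘_; _⇔_; mk⇔; Equivalence)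
import Function.Properties.Equivalence as ⇔
open import Relation.Binary.Bundles using (Setoid)
open import Relation.Binary.PropositionalEquality
  using (_≡_; _≢_; refl; sym; trans; cong; cong₂; subst; subst₂; module ≡-Reasoning)
import Relation.Binary.Reasoning.Setoid as ≈-Reasoning
open import Relation.Nullary using (¬_; Dec; yes; no)
open import Relation.Nullary.Decidable using (_×-dec_; map′; ¬?; decidable-stable)
import Data.Nat as ℕ
import Data.Nat.Properties as ℕₚ
import Data.Nat.Divisibility as ℕ∣

open import Defs

module ℤ² where

  open ℕ using (ℕ; zero; suc; _!; _∸_)
  open import Data.Integer using (ℤ; +_; -_; _+_; _-_; _*_; _^_; 0ℤ; 1ℤ; ∣_∣)
  open import Data.Integer.DivMod using (_%ℕ_; _/ℕ_; a≡a%ℕn+[a/ℕn]*n)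
  open import Data.Integer.Properties
    using (pos-*; pos-+; abs-*; +-injective; i-j≡0⇒i≡j; ∣i∣≡0⇒i≡0; [+m]-[+n]≡m⊖n; ∣m⊝n∣≤m⊔n;
           +-identityˡ; +-identityʳ; +-inverseʳ; *-comm; *-assoc; *-identityˡ; *-identityʳ)
  open import Data.Integer.Divisibility.Signed
    using (_∣_; _∣?_; divides; ∣-trans; ∣m∣n⇒∣m+n; ∣m⇒∣-m; ∣n⇒∣m*n; ∣m⇒∣m*n;
           *-monoʳ-∣; *-monoˡ-∣; *-cancelˡ-∣; *-cancelʳ-∣; ∣⇒∣ᵤ; ∣ᵤ⇒∣)
  open import Data.Integer.Tactic.RingSolver using (solve-∀)
  open import Data.Nat.Combinatorics
    using (_C_; nCk+nC[k+1]≡[n+1]C[k+1]; k>n⇒nCk≡0; nCn≡1; nCk≡n!/k![n-k]!; k![n∸k]!∣n!)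

  ∣-resp : ∀ {k x y} → x ≡ y → k ∣ x → k ∣ y
  ∣-resp refl d = d

  ∣0 : ∀ k → k ∣ 0ℤ
  ∣0 k = divides 0ℤ refl

  ∣-*ʳ : ∀ m n → + m ∣ + (m ℕ.* n)
  ∣-*ʳ m n = divides (+ n) (trans (pos-* m n) (*-comm (+ m) (+ n)))

  pos-*-monoʳ-∣ : ∀ m {q x} → + q ∣ x → + (m ℕ.* q) ∣ + m * x
  pos-*-monoʳ-∣ m {q} {x} d = subst (_∣ + m * x) (sym (pos-* m q)) (*-monoʳ-∣ (+ m) d)

  -- A record rather than a synonym, so that x and y can be inferred from a proof.
  infix 4 _≡_[mod_]
  record _≡_[mod_] (x y : ℤ) (q : ℕ) : Set where
    constructor modulo
    field divides-difference : + q ∣ x - y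

  ≡-refl : ∀ {q} x → x ≡ x [mod q ]
  ≡-refl {q} x = modulo (∣-resp (sym (+-inverseʳ x)) (∣0 (+ q)))

  ≡-reflexive : ∀ {q x y} → x ≡ y → x ≡ y [mod q ]
  ≡-reflexive {x = x} refl = ≡-refl x

  ≡-sym : ∀ {q x y} → x ≡ y [mod q ] → y ≡ x [mod q ]
  ≡-sym {x = x} {y} (modulo d) = modulo (∣-resp (eq x y) (∣m⇒∣-m d))
    where
    eq : ∀ x y → - (x - y) ≡ y - x
    eq = solve-∀

  ≡-trans : ∀ {q x y z} → x ≡ y [mod q ] → y ≡ z [mod q ] → x ≡ z [mod q ]
  ≡-trans {x = x} {y} {z} (modulo d) (modulo e) = modulo (∣-resp (eq x y z) (∣m∣n⇒∣m+n d e))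
    where
    eq : ∀ x y z → (x - y) + (y - z) ≡ x - z
    eq = solve-∀

  ≡-+ : ∀ {q x y u v} → x ≡ y [mod q ] → u ≡ v [mod q ] → x + u ≡ y + v [mod q ]
  ≡-+ {x = x} {y} {u} {v} (modulo d) (modulo e) = modulo (∣-resp (eq x y u v) (∣m∣n⇒∣m+n d e))
    where
    eq : ∀ x y u v → (x - y) + (u - v) ≡ (x + u) - (y + v)
    eq = solve-∀

  ≡-* : ∀ {q x y u v} → x ≡ y [mod q ] → u ≡ v [mod q ] → x * u ≡ y * v [mod q ]
  ≡-* {x = x} {y} {u} {v} (modulo d) (modulo e) =
    modulo (∣-resp (eq x y u v) (∣m∣n⇒∣m+n (∣n⇒∣m*n x e) (∣m⇒∣m*n v d)))
    where
    eq : ∀ x y u v → x * (u - v) + (x - y) * v ≡ x * u - y * v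
    eq = solve-∀

  ≡-weakenˡ : ∀ q₁ q₂ {x y} → x ≡ y [mod q₁ ℕ.* q₂ ] → x ≡ y [mod q₁ ]
  ≡-weakenˡ q₁ q₂ (modulo d) = modulo (∣-trans (∣-*ʳ q₁ q₂) d)

  ≡-weakenʳ : ∀ q₁ q₂ {x y} → x ≡ y [mod q₁ ℕ.* q₂ ] → x ≡ y [mod q₂ ]
  ≡-weakenʳ q₁ q₂ (modulo d) = modulo (∣-trans (subst (λ q → + q₂ ∣ + q) (ℕₚ.*-comm q₂ q₁) (∣-*ʳ q₂ q₁)) d)

  ≡-*-cancel : ∀ m {q x y} .{{_ : ℕ.NonZero m}} → + m * x ≡ + m * y [mod m ℕ.* q ] → x ≡ y [mod q ]
  ≡-*-cancel m {q} {x} {y} (modulo d) =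
    modulo (*-cancelˡ-∣ (+ m) (subst₂ _∣_ (pos-* m q) (eq (+ m) x y) d))
    where
    eq : ∀ a x y → a * x - a * y ≡ a * (x - y)
    eq = solve-∀

  ≡-%ℕ : ∀ c m .{{_ : ℕ.NonZero m}} → + (c %ℕ m) ≡ c [mod m ]
  ≡-%ℕ c m = modulo (divides (- (c /ℕ m)) (begin
    + (c %ℕ m) - c                                  ≡⟨ cong (λ t → + (c %ℕ m) - t) (a≡a%ℕn+[a/ℕn]*n c m) ⟩
    + (c %ℕ m) - (+ (c %ℕ m) + (c /ℕ m) * + m)      ≡⟨ eq (+ (c %ℕ m)) (c /ℕ m) (+ m) ⟩
    - (c /ℕ m) * + m                                ∎))
    where
    open ≡-Reasoning
    eq : ∀ r q m → r - (r + q * m) ≡ - q * m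
    eq = solve-∀

  ≡-mod⇒≡ : ∀ {m x y} → x ℕ.< m → y ℕ.< m → + x ≡ + y [mod m ] → x ≡ y
  ≡-mod⇒≡ {m} {x} {y} x<m y<m (modulo m∣d) = +-injective (i-j≡0⇒i≡j (+ x) (+ y) (∣i∣≡0⇒i≡0 ∣d∣≡0))
    where
    ∣d∣<m : ∣ + x - + y ∣ ℕ.< m
    ∣d∣<m = ℕₚ.≤-<-trans (subst (ℕ._≤ x ℕ.⊔ y) (cong ∣_∣ (sym ([+m]-[+n]≡m⊖n x y))) (∣m⊝n∣≤m⊔n x y))
                         (ℕₚ.⊔-lub x<m y<m)
    ∣d∣≡0 : ∣ + x - + y ∣ ≡ 0
    ∣d∣≡0 with ∣ + x - + y ∣ | ∣⇒∣ᵤ m∣d | ∣d∣<m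
    ... | zero  | _  | _   = refl
    ... | suc _ | m∣ | d<m = ⊥-elim (ℕₚ.<⇒≱ d<m (ℕ∣.∣⇒≤ m∣))

  V : Set
  V = ℤ × ℤ

  infixl 6 _+ᵛ_ _-ᵛ_
  infixr 7 _•_

  _+ᵛ_ : V → V → V
  (x , y) +ᵛ (u , v) = (x + u , y + v)

  _-ᵛ_ : V → V → V
  (x , y) -ᵛ (u , v) = (x - u , y - v)

  _•_ : ℤ → V → V
  c • (x , y) = (c * x , c * y)

  0ᵛ : V
  0ᵛ = (0ℤ , 0ℤ)

  +ᵛ-identityʳ : ∀ v → v +ᵛ 0ᵛ ≡ v
  +ᵛ-identityʳ (x , y) = cong₂ _,_ (+-identityʳ x) (+-identityʳ y)

  •-distribʳ : ∀ c d v → (c + d) • v ≡ c • v +ᵛ d • v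
  •-distribʳ c d (x , y) = cong₂ _,_ (eq c d x) (eq c d y)
    where
    eq : ∀ c d x → (c + d) * x ≡ c * x + d * x
    eq = solve-∀

  •-identityˡ : ∀ v → 1ℤ • v ≡ v
  •-identityˡ (x , y) = cong₂ _,_ (*-identityˡ x) (*-identityˡ y)

  •-• : ∀ c d v → c • (d • v) ≡ (c * d) • v
  •-• c d (x , y) = cong₂ _,_ (eq c d x) (eq c d y)
    where
    eq : ∀ c d x → c * (d * x) ≡ (c * d) * x
    eq = solve-∀

  infix 4 _∣ᵛ_ _≡ᵛ_[mod_]
  _∣ᵛ_ : ℕ → V → Set
  q ∣ᵛ (x , y) = (+ q ∣ x) × (+ q ∣ y)

  _≡ᵛ_[mod_] : V → V → ℕ → Set
  (x , y) ≡ᵛ (u , v) [mod q ] = (x ≡ u [mod q ]) × (y ≡ v [mod q ])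

  ∣ᵛ-resp : ∀ {q v w} → v ≡ w → q ∣ᵛ v → q ∣ᵛ w
  ∣ᵛ-resp refl d = d

  ∣ᵛ-• : ∀ {q} c {v} → q ∣ᵛ v → q ∣ᵛ c • v
  ∣ᵛ-• c (d₁ , d₂) = ∣n⇒∣m*n c d₁ , ∣n⇒∣m*n c d₂

  ∣ᵛ-•ˡ : ∀ {q c} → + q ∣ c → ∀ v → q ∣ᵛ c • v
  ∣ᵛ-•ˡ d (x , y) = ∣m⇒∣m*n x d , ∣m⇒∣m*n y d

  ∣ᵛ-*-• : ∀ m {q v} → q ∣ᵛ v → (m ℕ.* q) ∣ᵛ (+ m) • v
  ∣ᵛ-*-• m (d₁ , d₂) = pos-*-monoʳ-∣ m d₁ , pos-*-monoʳ-∣ m d₂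

  ∣ᵛ⇒≡• : ∀ {q v} → q ∣ᵛ v → ∃ λ t → v ≡ (+ q) • t
  ∣ᵛ⇒≡• {q} (divides t₁ refl , divides t₂ refl) = (t₁ , t₂) , cong₂ _,_ (*-comm t₁ (+ q)) (*-comm t₂ (+ q))

  ≡ᵛ⇒∣ᵛ- : ∀ {q v w} → v ≡ᵛ w [mod q ] → q ∣ᵛ v -ᵛ w
  ≡ᵛ⇒∣ᵛ- (modulo d₁ , modulo d₂) = d₁ , d₂

  ∣ᵛ-⇒≡ᵛ : ∀ {q v w} → q ∣ᵛ v -ᵛ w → v ≡ᵛ w [mod q ]
  ∣ᵛ-⇒≡ᵛ (d₁ , d₂) = modulo d₁ , modulo d₂

  ∣ᵛ⇒≡ᵛ0 : ∀ {q v} → q ∣ᵛ v → v ≡ᵛ 0ᵛ [mod q ]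
  ∣ᵛ⇒≡ᵛ0 {v = x , y} (d₁ , d₂) =
    modulo (∣-resp (sym (+-identityʳ x)) d₁) , modulo (∣-resp (sym (+-identityʳ y)) d₂)

  ≡ᵛ0⇒∣ᵛ : ∀ {q v} → v ≡ᵛ 0ᵛ [mod q ] → q ∣ᵛ v
  ≡ᵛ0⇒∣ᵛ {v = x , y} (modulo d₁ , modulo d₂) = ∣-resp (+-identityʳ x) d₁ , ∣-resp (+-identityʳ y) d₂

  -ᵛ≡0⇒≡ᵛ : ∀ {q v w} → v -ᵛ w ≡ᵛ 0ᵛ [mod q ] → v ≡ᵛ w [mod q ]
  -ᵛ≡0⇒≡ᵛ = ∣ᵛ-⇒≡ᵛ ∘ ≡ᵛ0⇒∣ᵛ

  ≡ᵛ-refl : ∀ {q} v → v ≡ᵛ v [mod q ]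
  ≡ᵛ-refl (x , y) = ≡-refl x , ≡-refl y

  ≡ᵛ-reflexive : ∀ {q v w} → v ≡ w → v ≡ᵛ w [mod q ]
  ≡ᵛ-reflexive {v = v} refl = ≡ᵛ-refl v

  ≡ᵛ-sym : ∀ {q v w} → v ≡ᵛ w [mod q ] → w ≡ᵛ v [mod q ]
  ≡ᵛ-sym (e₁ , e₂) = ≡-sym e₁ , ≡-sym e₂

  ≡ᵛ-trans : ∀ {q u v w} → u ≡ᵛ v [mod q ] → v ≡ᵛ w [mod q ] → u ≡ᵛ w [mod q ]
  ≡ᵛ-trans (d₁ , d₂) (e₁ , e₂) = ≡-trans d₁ e₁ , ≡-trans d₂ e₂

  ≡ᵛ-setoid : ℕ → Setoid _ _
  ≡ᵛ-setoid q = record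
    { Carrier = V
    ; _≈_ = _≡ᵛ_[mod q ]
    ; isEquivalence = record { refl = ≡ᵛ-refl _ ; sym = ≡ᵛ-sym ; trans = ≡ᵛ-trans }
    }

  ≡ᵛ-+ : ∀ {q v w v′ w′} → v ≡ᵛ w [mod q ] → v′ ≡ᵛ w′ [mod q ] → v +ᵛ v′ ≡ᵛ w +ᵛ w′ [mod q ]
  ≡ᵛ-+ (d₁ , d₂) (e₁ , e₂) = ≡-+ d₁ e₁ , ≡-+ d₂ e₂

  ≡ᵛ-• : ∀ {q} c {v w} → v ≡ᵛ w [mod q ] → c • v ≡ᵛ c • w [mod q ]
  ≡ᵛ-• c (d₁ , d₂) = ≡-* (≡-refl c) d₁ , ≡-* (≡-refl c) d₂

  ≡ᵛ-*-• : ∀ m {q v w} → v ≡ᵛ w [mod q ] → (+ m) • v ≡ᵛ (+ m) • w [mod m ℕ.* q ]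
  ≡ᵛ-*-• m {v = v} {w} v≡w =
    ∣ᵛ-⇒≡ᵛ (∣ᵛ-resp (•-distrib-−ᵛ (+ m) v w) (∣ᵛ-*-• m (≡ᵛ⇒∣ᵛ- v≡w)))
    where
    •-distrib-−ᵛ : ∀ c v w → c • (v -ᵛ w) ≡ c • v -ᵛ c • w
    •-distrib-−ᵛ c (x , y) (u , v) = cong₂ _,_ (eq c x u) (eq c y v)
      where
      eq : ∀ c x u → c * (x - u) ≡ c * x - c * u
      eq = solve-∀

  ≡ᵛ-*-•-cancel : ∀ m {q v w} .{{_ : ℕ.NonZero m}} →
                  (+ m) • v ≡ᵛ (+ m) • w [mod m ℕ.* q ] → v ≡ᵛ w [mod q ]
  ≡ᵛ-*-•-cancel m {v = _ , _} {_ , _} (e₁ , e₂) = ≡-*-cancel m e₁ , ≡-*-cancel m e₂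

  ≡ᵛ-weakenˡ : ∀ q₁ q₂ {v w} → v ≡ᵛ w [mod q₁ ℕ.* q₂ ] → v ≡ᵛ w [mod q₁ ]
  ≡ᵛ-weakenˡ q₁ q₂ (d₁ , d₂) = ≡-weakenˡ q₁ q₂ d₁ , ≡-weakenˡ q₁ q₂ d₂

  ≡ᵛ-weakenʳ : ∀ q₁ q₂ {v w} → v ≡ᵛ w [mod q₁ ℕ.* q₂ ] → v ≡ᵛ w [mod q₂ ]
  ≡ᵛ-weakenʳ q₁ q₂ (d₁ , d₂) = ≡-weakenʳ q₁ q₂ d₁ , ≡-weakenʳ q₁ q₂ d₂

  ∣ᵛ-weakenʳ : ∀ q₁ q₂ {v} → (q₁ ℕ.* q₂) ∣ᵛ v → q₂ ∣ᵛ v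
  ∣ᵛ-weakenʳ q₁ q₂ d = ≡ᵛ0⇒∣ᵛ (≡ᵛ-weakenʳ q₁ q₂ (∣ᵛ⇒≡ᵛ0 d))

  ∣ᵛ-resp-≡ᵛ : ∀ {q v w} → v ≡ᵛ w [mod q ] → q ∣ᵛ w → q ∣ᵛ v
  ∣ᵛ-resp-≡ᵛ v≡w q∣w = ≡ᵛ0⇒∣ᵛ (≡ᵛ-trans v≡w (∣ᵛ⇒≡ᵛ0 q∣w))

  +ᵛ-cancelˡ : ∀ {q} w {a b} → w +ᵛ a ≡ᵛ w +ᵛ b [mod q ] → a ≡ᵛ b [mod q ]
  +ᵛ-cancelˡ (w₁ , w₂) {a₁ , a₂} {b₁ , b₂} (modulo d₁ , modulo d₂) =
    modulo (∣-resp (eq w₁ a₁ b₁) d₁) , modulo (∣-resp (eq w₂ a₂ b₂) d₂)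
    where
    eq : ∀ w a b → (w + a) - (w + b) ≡ a - b
    eq = solve-∀

  ≡ᵛ-mod-1 : ∀ v w → v ≡ᵛ w [mod 1 ]
  ≡ᵛ-mod-1 (x , y) (u , v) = modulo (divides (x - u) (sym (*-identityʳ _))) ,
                             modulo (divides (y - v) (sym (*-identityʳ _)))

  p•≡0 : ∀ p v → (+ p) • v ≡ᵛ 0ᵛ [mod p ]
  p•≡0 p v = ∣ᵛ⇒≡ᵛ0 (∣ᵛ-•ˡ (divides 1ℤ (sym (*-identityˡ (+ p)))) v)

  ∣ᵛ? : ∀ q v → Dec (q ∣ᵛ v)
  ∣ᵛ? q (x , y) = (+ q ∣? x) ×-dec (+ q ∣? y)

  ≡ᵛ? : ∀ q v w → Dec (v ≡ᵛ w [mod q ])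
  ≡ᵛ? q v w = map′ ∣ᵛ-⇒≡ᵛ ≡ᵛ⇒∣ᵛ- (∣ᵛ? q (v -ᵛ w))

  data Mat : Set where
    mat : (a b c d : ℤ) → Mat

  infixr 8 _·_
  infixl 7 _⊗_

  _·_ : Mat → V → V
  mat a b c d · (x , y) = (a * x + b * y , c * x + d * y)

  _⊗_ : Mat → Mat → Mat
  mat a b c d ⊗ mat a′ b′ c′ d′ =
    mat (a * a′ + b * c′) (a * b′ + b * d′) (c * a′ + d * c′) (c * b′ + d * d′)

  I : Mat
  I = mat 1ℤ 0ℤ 0ℤ 1ℤ

  _−I : Mat → Mat
  mat a b c d −I = mat (a - 1ℤ) b c (d - 1ℤ)

  det : Mat → ℤ
  det (mat a b c d) = a * d - b * c

  adj : Mat → Mat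
  adj (mat a b c d) = mat d (- b) (- c) a

  pow : Mat → ℕ → Mat
  pow A zero    = I
  pow A (suc n) = A ⊗ pow A n

  ·-⊗ : ∀ A B z → (A ⊗ B) · z ≡ A · (B · z)
  ·-⊗ (mat a b c d) (mat a′ b′ c′ d′) (x , y) = cong₂ _,_ (eq a b a′ b′ c′ d′ x y) (eq c d a′ b′ c′ d′ x y)
    where
    eq : ∀ a b a′ b′ c′ d′ x y →
         (a * a′ + b * c′) * x + (a * b′ + b * d′) * y ≡ a * (a′ * x + b′ * y) + b * (c′ * x + d′ * y)
    eq = solve-∀

  I-· : ∀ z → I · z ≡ z
  I-· (x , y) = cong₂ _,_ (eq₁ x y) (eq₂ x y)
    where
    eq₁ : ∀ x y → 1ℤ * x + 0ℤ * y ≡ x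
    eq₁ = solve-∀
    eq₂ : ∀ x y → 0ℤ * x + 1ℤ * y ≡ y
    eq₂ = solve-∀

  ·-0ᵛ : ∀ A → A · 0ᵛ ≡ 0ᵛ
  ·-0ᵛ (mat a b c d) = cong₂ _,_ (eq a b) (eq c d)
    where
    eq : ∀ a b → a * 0ℤ + b * 0ℤ ≡ 0ℤ
    eq = solve-∀

  ·-+ᵛ : ∀ A v w → A · (v +ᵛ w) ≡ A · v +ᵛ A · w
  ·-+ᵛ (mat a b c d) (x , y) (u , v) = cong₂ _,_ (eq a b x y u v) (eq c d x y u v)
    where
    eq : ∀ a b x y u v → a * (x + u) + b * (y + v) ≡ (a * x + b * y) + (a * u + b * v)
    eq = solve-∀

  ·--ᵛ : ∀ A v w → A · (v -ᵛ w) ≡ A · v -ᵛ A · w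
  ·--ᵛ (mat a b c d) (x , y) (u , v) = cong₂ _,_ (eq a b x y u v) (eq c d x y u v)
    where
    eq : ∀ a b x y u v → a * (x - u) + b * (y - v) ≡ (a * x + b * y) - (a * u + b * v)
    eq = solve-∀

  ·-• : ∀ A c v → A · (c • v) ≡ c • (A · v)
  ·-• (mat a b c′ d) c (x , y) = cong₂ _,_ (eq a b c x y) (eq c′ d c x y)
    where
    eq : ∀ a b c x y → a * (c * x) + b * (c * y) ≡ c * (a * x + b * y)
    eq = solve-∀

  ·-−I : ∀ A z → A · z ≡ z +ᵛ (A −I) · z
  ·-−I (mat a b c d) (x , y) = cong₂ _,_ (eq a b x y) (eq′ c d x y)
    where
    eq : ∀ a b x y → a * x + b * y ≡ x + ((a - 1ℤ) * x + b * y)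
    eq = solve-∀
    eq′ : ∀ c d x y → c * x + d * y ≡ y + (c * x + (d - 1ℤ) * y)
    eq′ = solve-∀

  ∣ᵛ-· : ∀ {q} A {v} → q ∣ᵛ v → q ∣ᵛ A · v
  ∣ᵛ-· (mat a b c d) (d₁ , d₂) =
    ∣m∣n⇒∣m+n (∣n⇒∣m*n a d₁) (∣n⇒∣m*n b d₂) , ∣m∣n⇒∣m+n (∣n⇒∣m*n c d₁) (∣n⇒∣m*n d d₂)

  ·-cong : ∀ {q} A {v w} → v ≡ᵛ w [mod q ] → A · v ≡ᵛ A · w [mod q ]
  ·-cong A {v} {w} e = ∣ᵛ-⇒≡ᵛ (∣ᵛ-resp (·--ᵛ A v w) (∣ᵛ-· A (≡ᵛ⇒∣ᵛ- e)))

  pow-1 : ∀ A z → pow A 1 · z ≡ A · z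
  pow-1 A z = trans (·-⊗ A I z) (cong (A ·_) (I-· z))

  pow-+ : ∀ A m n z → pow A (m ℕ.+ n) · z ≡ pow A m · (pow A n · z)
  pow-+ A zero    n z = sym (I-· _)
  pow-+ A (suc m) n z = begin
    (A ⊗ pow A (m ℕ.+ n)) · z  ≡⟨ ·-⊗ A _ z ⟩
    A · (pow A (m ℕ.+ n) · z)  ≡⟨ cong (A ·_) (pow-+ A m n z) ⟩
    A · (pow A m · (pow A n · z))  ≡⟨ ·-⊗ A _ _ ⟨
    (A ⊗ pow A m) · (pow A n · z)  ∎
    where open ≡-Reasoning

  pow-* : ∀ A m n z → pow A (m ℕ.* n) · z ≡ pow (pow A n) m · z
  pow-* A zero    n z = refl
  pow-* A (suc m) n z = begin
    pow A (n ℕ.+ m ℕ.* n) · z          ≡⟨ pow-+ A n (m ℕ.* n) z ⟩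
    pow A n · (pow A (m ℕ.* n) · z)    ≡⟨ cong (pow A n ·_) (pow-* A m n z) ⟩
    pow A n · (pow (pow A n) m · z)    ≡⟨ ·-⊗ (pow A n) _ z ⟨
    (pow A n ⊗ pow (pow A n) m) · z    ∎
    where open ≡-Reasoning

  det-⊗ : ∀ A B → det (A ⊗ B) ≡ det A * det B
  det-⊗ (mat a b c d) (mat a′ b′ c′ d′) = eq a b c d a′ b′ c′ d′
    where
    eq : ∀ a b c d a′ b′ c′ d′ →
         (a * a′ + b * c′) * (c * b′ + d * d′) - (a * b′ + b * d′) * (c * a′ + d * c′)
         ≡ (a * d - b * c) * (a′ * d′ - b′ * c′)
    eq = solve-∀

  det-pow : ∀ A n → det A ≡ 1ℤ → det (pow A n) ≡ 1ℤ
  det-pow A zero    _  = refl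
  det-pow A (suc n) d₁ = trans (det-⊗ A (pow A n)) (cong₂ _*_ d₁ (det-pow A n d₁))

  adj-· : ∀ A z → det A ≡ 1ℤ → adj A · (A · z) ≡ z
  adj-· (mat a b c d) (x , y) d₁ = cong₂ _,_
    (trans (eq₁ a b c d x y) (trans (cong (_* x) d₁) (*-identityˡ x)))
    (trans (eq₂ a b c d x y) (trans (cong (_* y) d₁) (*-identityˡ y)))
    where
    eq₁ : ∀ a b c d x y → d * (a * x + b * y) + (- b) * (c * x + d * y) ≡ (a * d - b * c) * x
    eq₁ = solve-∀
    eq₂ : ∀ a b c d x y → (- c) * (a * x + b * y) + a * (c * x + d * y) ≡ (a * d - b * c) * y
    eq₂ = solve-∀

  ·-cancel : ∀ {q} A {v w} → det A ≡ 1ℤ → A · v ≡ᵛ A · w [mod q ] → v ≡ᵛ w [mod q ]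
  ·-cancel A {v} {w} d₁ e =
    subst₂ (_≡ᵛ_[mod _ ]) (adj-· A v d₁) (adj-· A w d₁) (·-cong (adj A) e)

  infix 4 _≈_[mod_]
  _≈_[mod_] : Mat → Mat → ℕ → Set
  A ≈ B [mod q ] = ∀ z → A · z ≡ᵛ B · z [mod q ]

  pow-cong : ∀ {q A B} → A ≈ B [mod q ] → ∀ n → pow A n ≈ pow B n [mod q ]
  pow-cong         _   zero    z = ≡ᵛ-refl _
  pow-cong {A = A} {B} A≈B (suc n) z = begin
    (A ⊗ pow A n) · z  ≡⟨ ·-⊗ A (pow A n) z ⟩
    A · (pow A n · z)  ≈⟨ ·-cong A (pow-cong A≈B n z) ⟩
    A · (pow B n · z)  ≈⟨ A≈B _ ⟩
    B · (pow B n · z)  ≡⟨ ·-⊗ B (pow B n) z ⟨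
    (B ⊗ pow B n) · z  ∎
    where open ≈-Reasoning (≡ᵛ-setoid _)

  pow-≈I : ∀ {q A} → A ≈ I [mod q ] → ∀ m → pow A m ≈ I [mod q ]
  pow-≈I {A = A} A≈I m z = ≡ᵛ-trans (pow-cong A≈I m z) (≡ᵛ-reflexive (pow-I m z))
    where
    pow-I : ∀ m z → pow I m · z ≡ I · z
    pow-I zero    z = refl
    pow-I (suc m) z = trans (·-⊗ I (pow I m) z) (trans (I-· _) (pow-I m z))

  -- The Frobenius congruence Gᵖ ≡ I + (G − I)ᵖ (mod p)

  ∑ᵛ : ℕ → (ℕ → V) → V
  ∑ᵛ zero    f = 0ᵛ
  ∑ᵛ (suc n) f = f 0 +ᵛ ∑ᵛ n (λ k → f (suc k))

  ∑ᵛ-cong : ∀ n {f g} → (∀ k → f k ≡ g k) → ∑ᵛ n f ≡ ∑ᵛ n g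
  ∑ᵛ-cong zero    f≗g = refl
  ∑ᵛ-cong (suc n) f≗g = cong₂ _+ᵛ_ (f≗g 0) (∑ᵛ-cong n (λ k → f≗g (suc k)))

  ∑ᵛ-distrib-+ᵛ : ∀ n f g → ∑ᵛ n (λ k → f k +ᵛ g k) ≡ ∑ᵛ n f +ᵛ ∑ᵛ n g
  ∑ᵛ-distrib-+ᵛ zero    f g = refl
  ∑ᵛ-distrib-+ᵛ (suc n) f g =
    trans (cong (f 0 +ᵛ g 0 +ᵛ_) (∑ᵛ-distrib-+ᵛ n _ _)) (interchange (f 0) (g 0) _ _)
    where
    interchange : ∀ a b c d → (a +ᵛ b) +ᵛ (c +ᵛ d) ≡ (a +ᵛ c) +ᵛ (b +ᵛ d)
    interchange (a₁ , a₂) (b₁ , b₂) (c₁ , c₂) (d₁ , d₂) = cong₂ _,_ (eq a₁ b₁ c₁ d₁) (eq a₂ b₂ c₂ d₂)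
      where
      eq : ∀ a b c d → (a + b) + (c + d) ≡ (a + c) + (b + d)
      eq = solve-∀

  ·-∑ᵛ : ∀ A n f → A · ∑ᵛ n f ≡ ∑ᵛ n (λ k → A · f k)
  ·-∑ᵛ A zero    f = ·-0ᵛ A
  ·-∑ᵛ A (suc n) f = trans (·-+ᵛ A (f 0) _) (cong (A · f 0 +ᵛ_) (·-∑ᵛ A n _))

  ∑ᵛ-drop-last : ∀ n f → f n ≡ 0ᵛ → ∑ᵛ (suc n) f ≡ ∑ᵛ n f
  ∑ᵛ-drop-last zero    f f0≡0 = trans (+ᵛ-identityʳ (f 0)) f0≡0
  ∑ᵛ-drop-last (suc n) f fn≡0 = cong (f 0 +ᵛ_) (∑ᵛ-drop-last n (λ k → f (suc k)) fn≡0)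

  ∑ᵛ-≡-last : ∀ {q} n f → (∀ k → k ℕ.< n → f k ≡ᵛ 0ᵛ [mod q ]) → ∑ᵛ (suc n) f ≡ᵛ f n [mod q ]
  ∑ᵛ-≡-last zero    f _ = ≡ᵛ-reflexive (+ᵛ-identityʳ (f 0))
  ∑ᵛ-≡-last (suc n) f f≡0 =
    ≡ᵛ-trans (≡ᵛ-+ (f≡0 0 (ℕ.s≤s ℕ.z≤n)) (∑ᵛ-≡-last n _ (λ k k<n → f≡0 (suc k) (ℕ.s≤s k<n))))
             (≡ᵛ-reflexive (zero-+ᵛ (f (suc n))))
    where
    zero-+ᵛ : ∀ v → 0ᵛ +ᵛ v ≡ v
    zero-+ᵛ (x , y) = cong₂ _,_ (+-identityˡ x) (+-identityˡ y)

  module Binomial (G : Mat) (z : V) where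

    Y : Mat
    Y = G −I

    term : ℕ → ℕ → V
    term n k = + (n C k) • (pow Y k · z)

    pascal : ∀ n k → term (suc n) (suc k) ≡ + (n C k) • (pow Y (suc k) · z) +ᵛ term n (suc k)
    pascal n k = begin
      + (suc n C suc k) • w                ≡⟨ cong (λ c → + c • w) (nCk+nC[k+1]≡[n+1]C[k+1] n k) ⟨
      + (n C k ℕ.+ n C suc k) • w          ≡⟨ cong (_• w) (pos-+ (n C k) (n C suc k)) ⟩
      (+ (n C k) + + (n C suc k)) • w      ≡⟨ •-distribʳ (+ (n C k)) (+ (n C suc k)) w ⟩
      + (n C k) • w +ᵛ + (n C suc k) • w   ∎
      where
      open ≡-Reasoning
      w = pow Y (suc k) · z

    Y-term : ∀ n k → Y · term n k ≡ + (n C k) • (pow Y (suc k) · z)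
    Y-term n k = trans (·-• Y (+ (n C k)) (pow Y k · z)) (cong (+ (n C k) •_) (sym (·-⊗ Y (pow Y k) z)))

    binomial : ∀ n → pow G n · z ≡ ∑ᵛ (suc n) (term n)
    binomial zero = sym (trans (+ᵛ-identityʳ _) (•-identityˡ _))
    binomial (suc n) = begin
      (G ⊗ pow G n) · z                  ≡⟨ ·-⊗ G (pow G n) z ⟩
      G · (pow G n · z)                  ≡⟨ cong (G ·_) (binomial n) ⟩
      G · ∑ᵛ (suc n) (term n)            ≡⟨ ·-−I G _ ⟩
      (t₀ +ᵛ R) +ᵛ Y · ∑ᵛ (suc n) (term n)
        ≡⟨ cong ((t₀ +ᵛ R) +ᵛ_) (trans (·-∑ᵛ Y (suc n) (term n)) (∑ᵛ-cong (suc n) (Y-term n))) ⟩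
      (t₀ +ᵛ R) +ᵛ S                     ≡⟨ rearrange t₀ R S ⟩
      t₀ +ᵛ (S +ᵛ R)
        ≡⟨ cong (λ r → t₀ +ᵛ (S +ᵛ r)) (∑ᵛ-drop-last n (λ k → term n (suc k)) last-term) ⟨
      t₀ +ᵛ (S +ᵛ ∑ᵛ (suc n) (λ k → term n (suc k)))
        ≡⟨ cong (t₀ +ᵛ_) (∑ᵛ-distrib-+ᵛ (suc n) (λ k → + (n C k) • (pow Y (suc k) · z)) (λ k → term n (suc k))) ⟨
      t₀ +ᵛ ∑ᵛ (suc n) (λ k → + (n C k) • (pow Y (suc k) · z) +ᵛ term n (suc k))
        ≡⟨ cong (t₀ +ᵛ_) (∑ᵛ-cong (suc n) (λ k → pascal n k)) ⟨
      t₀ +ᵛ ∑ᵛ (suc n) (λ k → term (suc n) (suc k))  ∎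
      where
      open ≡-Reasoning
      t₀ = term n 0
      R = ∑ᵛ n (λ k → term n (suc k))
      S = ∑ᵛ (suc n) (λ k → + (n C k) • (pow Y (suc k) · z))
      last-term : term n (suc n) ≡ 0ᵛ
      last-term = cong (λ c → + c • (pow Y (suc n) · z)) (k>n⇒nCk≡0 (ℕₚ.n<1+n n))
      rearrange : ∀ a b c → (a +ᵛ b) +ᵛ c ≡ a +ᵛ (c +ᵛ b)
      rearrange (a₁ , a₂) (b₁ , b₂) (c₁ , c₂) = cong₂ _,_ (eq a₁ b₁ c₁) (eq a₂ b₂ c₂)
        where
        eq : ∀ a b c → (a + b) + c ≡ a + (c + b)
        eq = solve-∀

  prime∤! : ∀ {p} → Prime p → ∀ m → m ℕ.< p → ¬ p ℕ∣.∣ m !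
  prime∤! {p} pp zero    _   p∣1 = ℕₚ.<⇒≢ (ℕ.nonTrivial⇒n>1 p {{prime⇒nonTrivial pp}}) (sym (ℕ∣.∣1⇒≡1 p∣1))
  prime∤! {p} pp (suc m) m<p p∣m! with euclidsLemma (suc m) (m !) pp p∣m!
  ... | inj₁ p∣1+m = ℕₚ.<⇒≱ m<p (ℕ∣.∣⇒≤ p∣1+m)
  ... | inj₂ p∣m!  = prime∤! pp m (ℕₚ.<-trans (ℕₚ.n<1+n m) m<p) p∣m!

  prime∣C : ∀ {p} → Prime p → ∀ k → 0 ℕ.< k → k ℕ.< p → p ℕ∣.∣ p C k
  prime∣C {suc p′} pp k 0<k k<p with euclidsLemma (p C k) D pp p∣C*D
    where
    p = suc p′
    D = k ! ℕ.* (p ∸ k) !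
    instance _ = k ℕₚ.!* (p ∸ k) !≢0
    C*D≡p! : (p C k) ℕ.* D ≡ p !
    C*D≡p! = trans (cong (λ c → c ℕ.* D) (nCk≡n!/k![n-k]! (ℕₚ.<⇒≤ k<p)))
                   (trans (ℕₚ.*-comm _ D) (m*[n/m]≡n (k![n∸k]!∣n! (ℕₚ.<⇒≤ k<p))))
    p∣C*D : p ℕ∣.∣ (p C k) ℕ.* D
    p∣C*D = subst (p ℕ∣.∣_) (sym C*D≡p!) (ℕ∣.m∣m*n (p′ !))
  ... | inj₁ p∣C = p∣C
  ... | inj₂ p∣D with euclidsLemma (k !) ((suc p′ ∸ k) !) pp p∣D
  ...   | inj₁ p∣k!   = ⊥-elim (prime∤! pp k k<p p∣k!)
  ...   | inj₂ p∣p-k! = ⊥-elim (prime∤! pp (suc p′ ∸ k) (ℕₚ.∸-monoʳ-< {suc p′} 0<k (ℕₚ.<⇒≤ k<p)) p∣p-k!)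

  frobenius : ∀ {p} → Prime p → ∀ G z → pow G p · z ≡ᵛ z +ᵛ pow (G −I) p · z [mod p ]
  frobenius {suc p′} pp G z = begin
    pow G p · z                                      ≡⟨ binomial p ⟩
    term p 0 +ᵛ ∑ᵛ p (λ k → term p (suc k))          ≈⟨ ≡ᵛ-+ (≡ᵛ-reflexive (•-identityˡ (I · z)))
                                                           (∑ᵛ-≡-last p′ _ inner-terms-vanish) ⟩
    I · z +ᵛ term p p                                 ≡⟨ cong₂ _+ᵛ_ (I-· z) last-term ⟩
    z +ᵛ pow Y p · z                                 ∎
    where
    open Binomial G z
    open ≈-Reasoning (≡ᵛ-setoid (suc p′))
    p = suc p′
    inner-terms-vanish : ∀ k → k ℕ.< p′ → term p (suc k) ≡ᵛ 0ᵛ [mod p ]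
    inner-terms-vanish k k<p′ =
      ∣ᵛ⇒≡ᵛ0 (∣ᵛ-•ˡ {c = + (p C suc k)} (∣ᵤ⇒∣ (prime∣C pp (suc k) (ℕ.s≤s ℕ.z≤n) (ℕ.s≤s k<p′)))
                     (pow Y (suc k) · z))
    last-term : term p p ≡ pow Y p · z
    last-term = trans (cong (λ c → + c • (pow Y p · z)) (nCn≡1 p)) (•-identityˡ _)

  frobenius-iterate : ∀ {p} → Prime p → ∀ e G z →
                      pow G (p ℕ.^ e) · z ≡ᵛ z +ᵛ pow (G −I) (p ℕ.^ e) · z [mod p ]
  frobenius-iterate pp zero G z =
    ≡ᵛ-reflexive (trans (pow-1 G z) (trans (·-−I G z) (cong (z +ᵛ_) (sym (pow-1 (G −I) z)))))
  frobenius-iterate {p} pp (suc e) G z = begin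
    pow G (p ℕ.* p ℕ.^ e) · z      ≡⟨ pow-* G p (p ℕ.^ e) z ⟩
    pow H p · z                     ≈⟨ frobenius pp H z ⟩
    z +ᵛ pow (H −I) p · z           ≈⟨ ≡ᵛ-+ (≡ᵛ-refl z) (pow-cong H−I≈Yᵉ p z) ⟩
    z +ᵛ pow Yᵉ p · z               ≡⟨ cong (z +ᵛ_) (pow-* (G −I) p (p ℕ.^ e) z) ⟨
    z +ᵛ pow (G −I) (p ℕ.* p ℕ.^ e) · z  ∎
    where
    open ≈-Reasoning (≡ᵛ-setoid p)
    H = pow G (p ℕ.^ e)
    Yᵉ = pow (G −I) (p ℕ.^ e)
    H−I≈Yᵉ : H −I ≈ Yᵉ [mod p ]
    H−I≈Yᵉ w = +ᵛ-cancelˡ w (≡ᵛ-trans (≡ᵛ-reflexive (sym (·-−I H w))) (frobenius-iterate pp e G w))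

  Primitive : ℕ → V → Set
  Primitive p u = ¬ p ∣ᵛ u

  prime∣*⇒∣⊎∣ : ∀ {p} → Prime p → ∀ x y → + p ∣ x * y → (+ p ∣ x) ⊎ (+ p ∣ y)
  prime∣*⇒∣⊎∣ {p} pp x y p∣xy
    with euclidsLemma ∣ x ∣ ∣ y ∣ pp (subst (p ℕ∣.∣_) (abs-* x y) (∣⇒∣ᵤ p∣xy))
  ... | inj₁ p∣x = inj₁ (∣ᵤ⇒∣ p∣x)
  ... | inj₂ p∣y = inj₂ (∣ᵤ⇒∣ p∣y)

  prime∣^⇒∣ : ∀ {p} → Prime p → ∀ c n → + p ∣ c ^ n → + p ∣ c
  prime∣^⇒∣ {p} pp c zero    p∣1 = ⊥-elim (ℕₚ.<⇒≢ (ℕ.nonTrivial⇒n>1 p {{prime⇒nonTrivial pp}})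
                                                   (sym (ℕ∣.∣1⇒≡1 (∣⇒∣ᵤ p∣1))))
  prime∣^⇒∣ {p} pp c (suc n) p∣cᶜ with prime∣*⇒∣⊎∣ pp c (c ^ n) p∣cᶜ
  ... | inj₁ p∣c  = p∣c
  ... | inj₂ p∣cⁿ = prime∣^⇒∣ pp c n p∣cⁿ

  prime∣•-primitive : ∀ {p} → Prime p → ∀ c {u} → Primitive p u → p ∣ᵛ c • u → + p ∣ c
  prime∣•-primitive pp c {u₁ , u₂} prim (d₁ , d₂)
    with prime∣*⇒∣⊎∣ pp c u₁ d₁ | prime∣*⇒∣⊎∣ pp c u₂ d₂
  ... | inj₁ p∣c | _        = p∣c
  ... | inj₂ _   | inj₁ p∣c = p∣c
  ... | inj₂ p∣x | inj₂ p∣y = ⊥-elim (prim (p∣x , p∣y))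

  prime-*-•-cancel : ∀ {p} → Prime p → ∀ m c {x} .{{_ : ℕ.NonZero m}} → ¬ + p ∣ c → m ∣ᵛ x →
                     (p ℕ.* m) ∣ᵛ c • x → (p ℕ.* m) ∣ᵛ x
  prime-*-•-cancel {p} pp m c p∤c (d₁ , d₂) (e₁ , e₂) = cancel d₁ e₁ , cancel d₂ e₂
    where
    cancel : ∀ {y} → + m ∣ y → + (p ℕ.* m) ∣ c * y → + (p ℕ.* m) ∣ y
    cancel {y} (divides t refl) pm∣cy with prime∣*⇒∣⊎∣ pp c t
      (*-cancelʳ-∣ (+ m) (subst₂ _∣_ (pos-* p m) (sym (*-assoc c t (+ m))) pm∣cy))
    ... | inj₁ p∣c = ⊥-elim (p∤c p∣c)
    ... | inj₂ p∣t = subst (_∣ t * + m) (sym (pos-* p m)) (*-monoˡ-∣ (+ m) p∣t)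

  -- Unipotence modulo p

  trace−2 : Mat → ℤ
  trace−2 (mat a b c d) = a + d - + 2

  cayley-hamilton : ∀ G z → det G ≡ 1ℤ → (G −I) · ((G −I) · z) ≡ trace−2 G • (G · z)
  cayley-hamilton (mat a b c d) (x , y) det≡1 = cong₂ _,_
    (trans (eq₁ a b c d x y) (trans (cong (λ t → s * (a * x + b * y) + (1ℤ - t) * x) det≡1) (eq₃ _ x)))
    (trans (eq₂ a b c d x y) (trans (cong (λ t → s * (c * x + d * y) + (1ℤ - t) * y) det≡1) (eq₃ _ y)))
    where
    s = a + d - + 2
    eq₁ : ∀ a b c d x y → (a - 1ℤ) * ((a - 1ℤ) * x + b * y) + b * (c * x + (d - 1ℤ) * y)
                        ≡ (a + d - + 2) * (a * x + b * y) + (1ℤ - (a * d - b * c)) * x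
    eq₁ = solve-∀
    eq₂ : ∀ a b c d x y → c * ((a - 1ℤ) * x + b * y) + (d - 1ℤ) * (c * x + (d - 1ℤ) * y)
                        ≡ (a + d - + 2) * (c * x + d * y) + (1ℤ - (a * d - b * c)) * y
    eq₂ = solve-∀
    eq₃ : ∀ s x → s + (1ℤ - 1ℤ) * x ≡ s
    eq₃ = solve-∀

  pow-−I-double : ∀ G → det G ≡ 1ℤ → ∀ n z → pow (G −I) (n ℕ.+ n) · z ≡ (trace−2 G ^ n) • (pow G n · z)
  pow-−I-double G det≡1 zero    z = sym (•-identityˡ _)
  pow-−I-double G det≡1 (suc n) z = begin
    pow Y (suc n ℕ.+ suc n) · z         ≡⟨ cong (λ k → pow Y (suc k) · z) (ℕₚ.+-suc n n) ⟩
    (Y ⊗ (Y ⊗ pow Y (n ℕ.+ n))) · z     ≡⟨ ·-⊗ Y _ z ⟩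
    Y · ((Y ⊗ pow Y (n ℕ.+ n)) · z)     ≡⟨ cong (Y ·_) (·-⊗ Y _ z) ⟩
    Y · (Y · (pow Y (n ℕ.+ n) · z))     ≡⟨ cayley-hamilton G _ det≡1 ⟩
    s • (G · (pow Y (n ℕ.+ n) · z))     ≡⟨ cong (λ v → s • (G · v)) (pow-−I-double G det≡1 n z) ⟩
    s • (G · ((s ^ n) • (pow G n · z))) ≡⟨ cong (s •_) (·-• G (s ^ n) _) ⟩
    s • ((s ^ n) • (G · (pow G n · z))) ≡⟨ •-• s (s ^ n) _ ⟩
    (s ^ suc n) • (G · (pow G n · z))   ≡⟨ cong ((s ^ suc n) •_) (·-⊗ G (pow G n) z) ⟨
    (s ^ suc n) • (pow G (suc n) · z)   ∎
    where
    open ≡-Reasoning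
    Y = G −I
    s = trace−2 G

  unipotent-pow : ∀ {q} G → (∀ z → (G −I) · ((G −I) · z) ≡ᵛ 0ᵛ [mod q ]) →
                  ∀ m z → pow G m · z ≡ᵛ z +ᵛ (+ m) • ((G −I) · z) [mod q ]
  unipotent-pow G Y²≡0 zero    z = ≡ᵛ-reflexive (trans (I-· z) (sym (z+0•v z ((G −I) · z))))
    where
    z+0•v : ∀ z v → z +ᵛ 0ℤ • v ≡ z
    z+0•v (z₁ , z₂) (v₁ , v₂) = cong₂ _,_ (+-identityʳ z₁) (+-identityʳ z₂)
  unipotent-pow {q} G Y²≡0 (suc m) z = begin
    (G ⊗ pow G m) · z                                ≡⟨ ·-⊗ G (pow G m) z ⟩
    G · (pow G m · z)                                ≈⟨ ·-cong G (unipotent-pow G Y²≡0 m z) ⟩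
    G · (z +ᵛ (+ m) • y)                             ≡⟨ ·-−I G _ ⟩
    (z +ᵛ (+ m) • y) +ᵛ Y · (z +ᵛ (+ m) • y)         ≡⟨ cong ((z +ᵛ (+ m) • y) +ᵛ_)
                                                          (trans (·-+ᵛ Y z _) (cong (y +ᵛ_) (·-• Y (+ m) y))) ⟩
    (z +ᵛ (+ m) • y) +ᵛ (y +ᵛ (+ m) • (Y · y))      ≈⟨ ≡ᵛ-+ (≡ᵛ-refl (z +ᵛ (+ m) • y))
                                                          (≡ᵛ-+ (≡ᵛ-refl y) (≡ᵛ-• (+ m) (Y²≡0 z))) ⟩
    (z +ᵛ (+ m) • y) +ᵛ (y +ᵛ (+ m) • 0ᵛ)           ≡⟨ collect z y m ⟩
    z +ᵛ (+ suc m) • y                               ∎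
    where
    open ≈-Reasoning (≡ᵛ-setoid q)
    Y = G −I
    y = Y · z
    collect : ∀ z y m → (z +ᵛ (+ m) • y) +ᵛ (y +ᵛ (+ m) • 0ᵛ) ≡ z +ᵛ (+ suc m) • y
    collect (z₁ , z₂) (y₁ , y₂) m = cong₂ _,_ (eq z₁ y₁ (+ m)) (eq z₂ y₂ (+ m))
      where
      eq : ∀ z y m → (z + m * y) + (y + m * 0ℤ) ≡ z + (1ℤ + m) * y
      eq = solve-∀

  fixes-primitive⇒pow-p≈I : ∀ {p} → Prime p → ∀ G {u} → det G ≡ 1ℤ → Primitive p u →
                             ∀ e → pow G (p ℕ.^ e) · u ≡ᵛ u [mod p ] → pow G p ≈ I [mod p ]
  fixes-primitive⇒pow-p≈I {p} pp G {u} det≡1 prim e fixed z = begin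
    pow G p · z                      ≈⟨ unipotent-pow G Y²≡0 p z ⟩
    z +ᵛ (+ p) • (Y · z)             ≈⟨ ≡ᵛ-+ (≡ᵛ-refl z) (p•≡0 p (Y · z)) ⟩
    z +ᵛ 0ᵛ                          ≡⟨ trans (+ᵛ-identityʳ z) (sym (I-· z)) ⟩
    I · z                            ∎
    where
    open ≈-Reasoning (≡ᵛ-setoid p)
    pᵉ = p ℕ.^ e
    Y = G −I
    s = trace−2 G
    Yᵖᵉu≡0 : pow Y pᵉ · u ≡ᵛ 0ᵛ [mod p ]
    Yᵖᵉu≡0 = +ᵛ-cancelˡ u (≡ᵛ-trans (≡ᵛ-sym (frobenius-iterate pp e G u))
                                    (≡ᵛ-trans fixed (≡ᵛ-reflexive (sym (+ᵛ-identityʳ u)))))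
    sᵖᵉ•u≡0 : (s ^ pᵉ) • u ≡ᵛ 0ᵛ [mod p ]
    sᵖᵉ•u≡0 = ·-cancel (pow G pᵉ) (det-pow G pᵉ det≡1) (begin
      pow G pᵉ · ((s ^ pᵉ) • u)        ≡⟨ ·-• (pow G pᵉ) (s ^ pᵉ) u ⟩
      (s ^ pᵉ) • (pow G pᵉ · u)        ≡⟨ pow-−I-double G det≡1 pᵉ u ⟨
      pow Y (pᵉ ℕ.+ pᵉ) · u              ≡⟨ pow-+ Y pᵉ pᵉ u ⟩
      pow Y pᵉ · (pow Y pᵉ · u)          ≈⟨ ·-cong (pow Y pᵉ) Yᵖᵉu≡0 ⟩
      pow Y pᵉ · 0ᵛ                     ≡⟨ trans (·-0ᵛ (pow Y pᵉ)) (sym (·-0ᵛ (pow G pᵉ))) ⟩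
      pow G pᵉ · 0ᵛ                     ∎)
    p∣s : + p ∣ s
    p∣s = prime∣^⇒∣ pp (s) pᵉ (prime∣•-primitive pp (s ^ pᵉ) prim (≡ᵛ0⇒∣ᵛ sᵖᵉ•u≡0))
    Y²≡0 : ∀ z → Y · (Y · z) ≡ᵛ 0ᵛ [mod p ]
    Y²≡0 z = ≡ᵛ-trans (≡ᵛ-reflexive (cayley-hamilton G z det≡1)) (∣ᵛ⇒≡ᵛ0 (∣ᵛ-•ˡ p∣s (G · z)))

  ≈I-fixes-multiples : ∀ {q₁ q₂} A → A ≈ I [mod q₁ ] → ∀ {x} → q₂ ∣ᵛ x → A · x ≡ᵛ x [mod q₁ ℕ.* q₂ ]
  ≈I-fixes-multiples {q₁} {q₂} A A≈I {x₁ , x₂} (divides t₁ refl , divides t₂ refl) =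
    ∣ᵛ-⇒≡ᵛ (∣ᵛ-resp (scale A t₁ t₂ (+ q₂)) (subst (_∣ᵛ (+ q₂) • (A · t -ᵛ t)) (ℕₚ.*-comm q₂ q₁)
      (∣ᵛ-*-• q₂ (≡ᵛ⇒∣ᵛ- (≡ᵛ-trans (A≈I t) (≡ᵛ-reflexive (I-· t)))))))
    where
    t = (t₁ , t₂)
    scale : ∀ A t₁ t₂ q → q • (A · (t₁ , t₂) -ᵛ (t₁ , t₂)) ≡ A · (t₁ * q , t₂ * q) -ᵛ (t₁ * q , t₂ * q)
    scale (mat a b c d) t₁ t₂ q = cong₂ _,_ (eq₁ a b t₁ t₂ q) (eq₂ c d t₁ t₂ q)
      where
      eq₁ : ∀ a b t₁ t₂ q → q * (a * t₁ + b * t₂ - t₁) ≡ a * (t₁ * q) + b * (t₂ * q) - t₁ * q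
      eq₁ = solve-∀
      eq₂ : ∀ c d t₁ t₂ q → q * (c * t₁ + d * t₂ - t₂) ≡ c * (t₁ * q) + d * (t₂ * q) - t₂ * q
      eq₂ = solve-∀

  pow-displacement : ∀ {q₁ q₂} A → A ≈ I [mod q₁ ] → ∀ z → q₂ ∣ᵛ A · z -ᵛ z →
             ∀ m → pow A m · z -ᵛ z ≡ᵛ (+ m) • (A · z -ᵛ z) [mod q₁ ℕ.* q₂ ]
  pow-displacement A A≈I z q₂∣x zero = ≡ᵛ-reflexive (trans (cong (_-ᵛ z) (I-· z)) (z-z≡0•x z (A · z -ᵛ z)))
    where
    z-z≡0•x : ∀ z x → z -ᵛ z ≡ 0ℤ • x
    z-z≡0•x (z₁ , z₂) _ = cong₂ _,_ (+-inverseʳ z₁) (+-inverseʳ z₂)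
  pow-displacement {q₁} {q₂} A A≈I z q₂∣x (suc m) = begin
    (A ⊗ pow A m) · z -ᵛ z               ≡⟨ cong (_-ᵛ z) (·-⊗ A (pow A m) z) ⟩
    A · (pow A m · z) -ᵛ z               ≡⟨ split (pow A m · z) ⟩
    A · yₘ +ᵛ x                           ≈⟨ ≡ᵛ-+ (≈I-fixes-multiples A A≈I q₂∣yₘ) (≡ᵛ-refl x) ⟩
    yₘ +ᵛ x                               ≈⟨ ≡ᵛ-+ IH (≡ᵛ-refl x) ⟩
    (+ m) • x +ᵛ x                        ≡⟨ collect x m ⟩
    (+ suc m) • x                         ∎
    where
    open ≈-Reasoning (≡ᵛ-setoid (q₁ ℕ.* q₂))
    x = A · z -ᵛ z
    yₘ = pow A m · z -ᵛ z
    IH = pow-displacement A A≈I z q₂∣x m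
    q₂∣yₘ : q₂ ∣ᵛ yₘ
    q₂∣yₘ = ∣ᵛ-resp-≡ᵛ (≡ᵛ-weakenʳ q₁ q₂ IH) (∣ᵛ-• (+ m) q₂∣x)
    split : ∀ w → A · w -ᵛ z ≡ A · (w -ᵛ z) +ᵛ x
    split w = trans (telescope (A · w) (A · z) z) (cong (_+ᵛ x) (sym (·--ᵛ A w z)))
      where
      telescope : ∀ a b c → a -ᵛ c ≡ (a -ᵛ b) +ᵛ (b -ᵛ c)
      telescope (a₁ , a₂) (b₁ , b₂) (c₁ , c₂) = cong₂ _,_ (eq a₁ b₁ c₁) (eq a₂ b₂ c₂)
        where
        eq : ∀ a b c → a - c ≡ (a - b) + (b - c)
        eq = solve-∀
    collect : ∀ x m → (+ m) • x +ᵛ x ≡ (+ suc m) • x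
    collect (x₁ , x₂) m = cong₂ _,_ (eq x₁ (+ m)) (eq x₂ (+ m))
      where
      eq : ∀ x m → m * x + x ≡ (1ℤ + m) * x
      eq = solve-∀

  pow-lifts-fixed : ∀ {q₁ q₂} A → A ≈ I [mod q₁ ] → ∀ {z} → A · z ≡ᵛ z [mod q₂ ] →
                    pow A q₁ · z ≡ᵛ z [mod q₁ ℕ.* q₂ ]
  pow-lifts-fixed {q₁} A A≈I {z} Az≡z =
    -ᵛ≡0⇒≡ᵛ (≡ᵛ-trans (pow-displacement A A≈I z q₂∣x q₁) (∣ᵛ⇒≡ᵛ0 (∣ᵛ-*-• q₁ q₂∣x)))
    where
    q₂∣x = ≡ᵛ⇒∣ᵛ- Az≡z

  catMatrix : ℤ → ℤ → Mat
  catMatrix a b = mat 1ℤ a b (1ℤ + a * b)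

  det-catMatrix : ∀ a b → det (catMatrix a b) ≡ 1ℤ
  det-catMatrix = eq
    where
    eq : ∀ a b → 1ℤ * (1ℤ + a * b) - a * b ≡ 1ℤ
    eq = solve-∀

  toℤ² : Pt → V
  toℤ² (x , y) = (+ x , + y)

  catMap-≡ᵛ : ∀ m .{{_ : ℕ.NonZero m}} a b P → toℤ² (catMap m a b P) ≡ᵛ catMatrix a b · toℤ² P [mod m ]
  catMap-≡ᵛ m a b (x , y) =
    ≡-trans (≡-%ℕ (+ _) m) (≡-trans (≡-reflexive first)
      (≡-+ (≡-reflexive (sym (*-identityˡ (+ x)))) (≡-* (≡-%ℕ a m) (≡-refl (+ y))))) ,
    ≡-trans (≡-%ℕ (+ _) m) (≡-trans (≡-reflexive second)
      (≡-+ (≡-* (≡-%ℕ b m) (≡-refl (+ x))) (≡-* (≡-+ (≡-refl 1ℤ) (≡-* (≡-%ℕ a m) (≡-%ℕ b m))) (≡-refl (+ y)))))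
    where
    a′ = a %ℕ m
    b′ = b %ℕ m
    first : + (x ℕ.+ a′ ℕ.* y) ≡ + x + + a′ * + y
    first = trans (pos-+ x (a′ ℕ.* y)) (cong (λ t → + x + t) (pos-* a′ y))
    second : + (b′ ℕ.* x ℕ.+ (1 ℕ.+ a′ ℕ.* b′) ℕ.* y) ≡ + b′ * + x + (1ℤ + + a′ * + b′) * + y
    second = trans (pos-+ (b′ ℕ.* x) _) (cong₂ _+_ (pos-* b′ x)
      (trans (pos-* (1 ℕ.+ a′ ℕ.* b′) y)
             (cong (_* + y) (trans (pos-+ 1 (a′ ℕ.* b′)) (cong (λ t → 1ℤ + t) (pos-* a′ b′))))))



open ℤ²
open import Data.Nat
  using (ℕ; zero; suc; _+_; _*_; _∸_; _^_; _<_; _≤_; _≥_; z≤n; s≤s; NonZero; >-nonZero; >-nonZero⁻¹;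
         nonTrivial⇒n>1)
open import Data.Nat.Properties
  using (≤-refl; ≤-trans; <-trans; ≤-<-trans; <-≤-trans; <-irrefl; ≤-antisym; ≤-total; <⇒≤; <⇒≱; ≤-pred;
         n<1+n; n≤1+n; m<n⇒m<1+n; m≤n⇒m<n∨m≡n; m≤n⇒∃[o]m+o≡n; m∸n+n≡m; m+[n∸m]≡n; n≢0⇒n>0;
         +-comm; +-assoc; +-suc; +-identityʳ; +-cancelʳ-≡; *-comm; *-assoc; *-zeroʳ; *-identityʳ;
         *-distribˡ-+; *-cancelˡ-≡; *-cancelʳ-≡; *-cancelʳ-<; m*n≢0; m≤m*n; m≤n*m; m≤n+m; m<m*n;
         m^n≢0; ^-distribˡ-+-*; ≡ᵇ⇒≡; ≡⇒≡ᵇ; ≤ᵇ⇒≤; ≤⇒≤ᵇ)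
open import Data.Nat.Divisibility
  using (_∣_; _∣?_; divides; divides-refl; quotient; m∣n⇒n≡quotient*m; ∣-antisym; ∣-trans; 1∣_; ∣⇒≤; >⇒∤;
         m%n≡0⇒n∣m; ∣1⇒≡1; m∣m*n; *-cancelˡ-∣; *-cancelʳ-∣)
open import Data.Nat.Tactic.RingSolver using (solve-∀)
open import Data.Integer as ℤ using (ℤ; 1ℤ)
import Data.Integer.Properties as ℤₚ
open import Data.Integer.Divisibility.Signed using () renaming (_∣_ to _∣ℤ_; ∣⇒∣ᵤ to ∣ℤ⇒∣)

record ExactPeriod (C : Mat) (q : ℕ) (v : V) (T : ℕ) : Set where
  field
    positive : 0 < T
    returns  : pow C T · v ≡ᵛ v [mod q ]
    minimal  : ∀ i → 0 < i → i < T → ¬ pow C i · v ≡ᵛ v [mod q ]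
open ExactPeriod

least-witness : (P : ℕ → Set) → (∀ n → Dec (P n)) → ∀ {n} → P n →
                ∃ λ m → P m × (∀ i → i < m → ¬ P i)
least-witness P P? {n} Pn = search 0 n (λ _ ()) Pn
  where
  search : ∀ k n → (∀ i → i < k → ¬ P i) → P (k + n) → ∃ λ m → P m × (∀ i → i < m → ¬ P i)
  search k zero    below-k Pk+0 = k , subst P (+-identityʳ k) Pk+0 , below-k
  search k (suc n) below-k Pk+n with P? k
  ... | yes Pk = k , Pk , below-k
  ... | no ¬Pk = search (suc k) n below-1+k (subst P (+-suc k n) Pk+n)
    where
    below-1+k : ∀ i → i < suc k → ¬ P i
    below-1+k i (s≤s i≤k) with m≤n⇒m<n∨m≡n i≤k
    ... | inj₁ i<k  = below-k i i<k
    ... | inj₂ refl = ¬Pk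

positive-factor : ∀ m {n} → 0 < m * n → 0 < n
positive-factor m {zero}  0<m*0 = ⊥-elim (<-irrefl (sym (*-zeroʳ m)) 0<m*0)
positive-factor m {suc n} _     = s≤s z≤n

module _ {C : Mat} where

  pow-+-fixed : ∀ {q v} a b → pow C b · v ≡ᵛ v [mod q ] → pow C (a + b) · v ≡ᵛ pow C a · v [mod q ]
  pow-+-fixed {v = v} a b fixed = ≡ᵛ-trans (≡ᵛ-reflexive (pow-+ C a b v)) (·-cong (pow C a) fixed)

  pow-*-fixed : ∀ {q v T} → pow C T · v ≡ᵛ v [mod q ] → ∀ j → pow C (j * T) · v ≡ᵛ v [mod q ]
  pow-*-fixed {v = v} fixed zero    = ≡ᵛ-reflexive (I-· v)
  pow-*-fixed {T = T} fixed (suc j) = ≡ᵛ-trans (pow-+-fixed T (j * T) (pow-*-fixed fixed j)) fixed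

  period-∣ : ∀ {q v T n} → ExactPeriod C q v T → pow C n · v ≡ᵛ v [mod q ] → T ∣ n
  period-∣ {q} {v} {T} {n} P fixed = m%n≡0⇒n∣m n T r≡0
    where
    instance _ = >-nonZero (positive P)
    r = n % T
    r-fixed : pow C r · v ≡ᵛ v [mod q ]
    r-fixed = ≡ᵛ-trans (≡ᵛ-sym (pow-+-fixed r ((n / T) * T) (pow-*-fixed (returns P) (n / T))))
                       (≡ᵛ-trans (≡ᵛ-reflexive (cong (λ k → pow C k · v) (sym (m≡m%n+[m/n]*n n T)))) fixed)
    r≡0 : r ≡ 0
    r≡0 with r in r≡
    ... | zero  = refl
    ... | suc _ = ⊥-elim (minimal P r (subst (0 <_) (sym r≡) (s≤s z≤n)) (m%n<n n T) r-fixed)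

  period-unique : ∀ {q v T T′} → ExactPeriod C q v T → ExactPeriod C q v T′ → T ≡ T′
  period-unique P P′ = ∣-antisym (period-∣ P (returns P′)) (period-∣ P′ (returns P))

  period-exists : ∀ {q v n} → 0 < n → pow C n · v ≡ᵛ v [mod q ] → ∃ (ExactPeriod C q v)
  period-exists {q} {v} {suc n} _ fixed
    with least-witness (λ i → pow C (suc i) · v ≡ᵛ v [mod q ]) (λ i → ≡ᵛ? q (pow C (suc i) · v) v) {n} fixed
  ... | m , m-fixed , below-m = suc m , record
    { positive = s≤s z≤n
    ; returns  = m-fixed
    ; minimal  = λ { (suc i) _ (s≤s i<m) → below-m i i<m }
    }

  period-respects : ∀ {q v w T} → v ≡ᵛ w [mod q ] → ExactPeriod C q v T → ExactPeriod C q w T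
  period-respects {T = T} v≡w P = record
    { positive = positive P
    ; returns  = ≡ᵛ-trans (·-cong (pow C T) (≡ᵛ-sym v≡w)) (≡ᵛ-trans (returns P) v≡w)
    ; minimal  = λ i 0<i i<T w-fixed →
        minimal P i 0<i i<T (≡ᵛ-trans (·-cong (pow C i) v≡w) (≡ᵛ-trans w-fixed (≡ᵛ-sym v≡w)))
    }

  period-•-cancel : ∀ m {q u T} .{{_ : NonZero m}} →
                    ExactPeriod C (m * q) ((ℤ.+ m) • u) T → ExactPeriod C q u T
  period-•-cancel m {u = u} {T} P = record
    { positive = positive P
    ; returns  = ≡ᵛ-*-•-cancel m (≡ᵛ-trans (≡ᵛ-reflexive (sym (·-• (pow C T) (ℤ.+ m) u))) (returns P))
    ; minimal  = λ i 0<i i<T u-fixed →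
        minimal P i 0<i i<T (≡ᵛ-trans (≡ᵛ-reflexive (·-• (pow C i) (ℤ.+ m) u)) (≡ᵛ-*-• m u-fixed))
    }

  period-•-mono : ∀ m {q u T} .{{_ : NonZero m}} →
                  ExactPeriod C q u T → ExactPeriod C (m * q) ((ℤ.+ m) • u) T
  period-•-mono m {u = u} {T} P = record
    { positive = positive P
    ; returns  = ≡ᵛ-trans (≡ᵛ-reflexive (·-• (pow C T) (ℤ.+ m) u)) (≡ᵛ-*-• m (returns P))
    ; minimal  = λ i 0<i i<T mu-fixed →
        minimal P i 0<i i<T (≡ᵛ-*-•-cancel m (≡ᵛ-trans (≡ᵛ-reflexive (sym (·-• (pow C i) (ℤ.+ m) u))) mu-fixed))
    }

  period-of-multiple : ∀ {q v T} → q ∣ᵛ v → ExactPeriod C q v T → T ≡ 1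
  period-of-multiple {v = v} q∣v P = ∣1⇒≡1 (period-∣ P (≡ᵛ-trans (≡ᵛ-reflexive (pow-1 C v))
    (≡ᵛ-trans (∣ᵛ⇒≡ᵛ0 (∣ᵛ-· C q∣v)) (≡ᵛ-sym (∣ᵛ⇒≡ᵛ0 q∣v)))))

  period-mod-1 : ∀ {v T} → ExactPeriod C 1 v T → T ≡ 1
  period-mod-1 {v} P = ∣1⇒≡1 (period-∣ P (≡ᵛ-mod-1 (pow C 1 · v) v))

  module _ (det≡1 : det C ≡ 1ℤ) where

    pow-comm : ∀ a b v → pow C a · (pow C b · v) ≡ pow C b · (pow C a · v)
    pow-comm a b v = trans (sym (pow-+ C a b v)) (trans (cong (λ k → pow C k · v) (+-comm a b)) (pow-+ C b a v))

    period-orbit : ∀ {q v T} → ExactPeriod C q v T → ∀ i → ExactPeriod C q (pow C i · v) T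
    period-orbit {v = v} {T} P i = record
      { positive = positive P
      ; returns  = ≡ᵛ-trans (≡ᵛ-reflexive (pow-comm T i v)) (·-cong (pow C i) (returns P))
      ; minimal  = λ j 0<j j<T fixed → minimal P j 0<j j<T
          (·-cancel (pow C i) (det-pow C i det≡1) (≡ᵛ-trans (≡ᵛ-reflexive (pow-comm i j v)) fixed))
      }

    period-offset-zero : ∀ {q v T i j} → ExactPeriod C q v T → i ≤ j → j < T →
                         pow C i · v ≡ᵛ pow C j · v [mod q ] → j ≡ i
    period-offset-zero {v = v} {i = i} P i≤j j<T eq with m≤n⇒∃[o]m+o≡n i≤j
    ... | zero  , refl = +-identityʳ i
    ... | suc d , refl = ⊥-elim (>⇒∤ (≤-<-trans (m≤n+m (suc d) i) j<T) (period-∣ P d-fixed))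
      where
      d-fixed : pow C (suc d) · v ≡ᵛ v [mod _ ]
      d-fixed = ·-cancel (pow C i) (det-pow C i det≡1)
                  (≡ᵛ-sym (≡ᵛ-trans eq (≡ᵛ-reflexive (pow-+ C i (suc d) v))))

    period-injective : ∀ {q v T i j} → ExactPeriod C q v T → i < T → j < T →
                       pow C i · v ≡ᵛ pow C j · v [mod q ] → i ≡ j
    period-injective {i = i} {j} P i<T j<T eq with ≤-total i j
    ... | inj₁ i≤j = sym (period-offset-zero P i≤j j<T eq)
    ... | inj₂ j≤i = period-offset-zero P j≤i i<T (≡ᵛ-sym eq)

-- Exact periods modulo powers of a prime

module _ {p : ℕ} (pp : Prime p) where

  instance
    p-nonZero : NonZero p
    p-nonZero = prime⇒nonZero pp

  p>1 : 1 < p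
  p>1 = nonTrivial⇒n>1 p {{prime⇒nonTrivial pp}}

  p^-nonZero : ∀ n → NonZero (p ^ n)
  p^-nonZero n = m^n≢0 p n

  primitive-decomposition : ∀ n w → p ^ n ∣ᵛ w ⊎ ∃₂ λ j u → j < n × Primitive p u × w ≡ (ℤ.+ (p ^ j)) • u
  primitive-decomposition zero    w = inj₁ (≡ᵛ0⇒∣ᵛ (≡ᵛ-mod-1 w 0ᵛ))
  primitive-decomposition (suc n) w with ∣ᵛ? p w
  ... | no ¬p∣w = inj₂ (0 , w , s≤s z≤n , ¬p∣w , sym (•-identityˡ w))
  ... | yes p∣w with ∣ᵛ⇒≡• p∣w
  ...   | t , refl with primitive-decomposition n t
  ...     | inj₁ pⁿ∣t = inj₁ (∣ᵛ-*-• p pⁿ∣t)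
  ...     | inj₂ (j , u , j<n , prim , refl) =
    inj₂ (suc j , u , s≤s j<n , prim , trans (•-• (ℤ.+ p) (ℤ.+ (p ^ j)) u) (cong (_• u) (sym (ℤₚ.pos-* p (p ^ j)))))

  pow-p-reflects-fixed : ∀ {A} → A ≈ I [mod p * p ] → ∀ j z →
                         pow A p · z ≡ᵛ z [mod p ^ suc j ] → A · z ≡ᵛ z [mod p ^ j ]
  pow-p-reflects-fixed {A} A≈I zero    z _     = ≡ᵛ-mod-1 (A · z) z
  pow-p-reflects-fixed {A} A≈I (suc j) z fixed = -ᵛ≡0⇒≡ᵛ (≡ᵛ-*-•-cancel p (begin
    (ℤ.+ p) • x         ≈⟨ lift ⟨
    pow A p · z -ᵛ z    ≈⟨ ∣ᵛ⇒≡ᵛ0 (≡ᵛ⇒∣ᵛ- fixed) ⟩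
    0ᵛ                  ≡⟨ cong₂ _,_ (ℤₚ.*-zeroʳ (ℤ.+ p)) (ℤₚ.*-zeroʳ (ℤ.+ p)) ⟨
    (ℤ.+ p) • 0ᵛ        ∎))
    where
    open ≈-Reasoning (≡ᵛ-setoid (p ^ suc (suc j)))
    x = A · z -ᵛ z
    pʲ∣x : p ^ j ∣ᵛ x
    pʲ∣x = ≡ᵛ⇒∣ᵛ- (pow-p-reflects-fixed A≈I j z (≡ᵛ-weakenʳ p (p ^ suc j) fixed))
    lift : pow A p · z -ᵛ z ≡ᵛ (ℤ.+ p) • x [mod p ^ suc (suc j) ]
    lift = subst (λ q → pow A p · z -ᵛ z ≡ᵛ (ℤ.+ p) • x [mod q ]) (*-assoc p p (p ^ j))
                 (pow-displacement A A≈I z pʲ∣x p)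

  n<p*n : ∀ {n} → 0 < n → n < p * n
  n<p*n {n} 0<n = subst (n <_) (*-comm n p) (m<m*n n p {{>-nonZero 0<n}} p>1)

  module _ {C : Mat} where

    -- C^T ≡ I (mod p) lifts the return of v by one digit.  A return at q·T with 0 < q < p would give
    -- C^T v ≡ v (mod pⁿ⁺¹), which pow-p-reflects-fixed pushes down to C^B v ≡ v (mod pⁿ).
    period-lift : ∀ {B n v} → pow C B ≈ I [mod p * p ] →
                  ExactPeriod C (p ^ n) v (p * B) → ExactPeriod C (p ^ suc n) v (p * (p * B))
    period-lift {B} {n} {v} Cᴮ≈I P = record
      { positive = <-≤-trans (positive P) (m≤n*m (p * B) p)
      ; returns  = ≡ᵛ-trans (≡ᵛ-reflexive (pow-* C p T v)) (pow-lifts-fixed (pow C T) Cᵀ≈I (returns P))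
      ; minimal  = not-earlier
      }
      where
      T = p * B
      Cᵀ≈I : pow C T ≈ I [mod p ]
      Cᵀ≈I z = ≡ᵛ-trans (≡ᵛ-reflexive (pow-* C p B z)) (pow-≈I (λ w → ≡ᵛ-weakenˡ p p (Cᴮ≈I w)) p z)
      x = pow C T · v -ᵛ v
      pⁿ∣x : p ^ n ∣ᵛ x
      pⁿ∣x = ≡ᵛ⇒∣ᵛ- (returns P)
      not-earlier : ∀ i → 0 < i → i < p * T → ¬ pow C i · v ≡ᵛ v [mod p ^ suc n ]
      not-earlier i 0<i i<pT fixed with period-∣ {n = i} P (≡ᵛ-weakenʳ p (p ^ n) fixed)
      ... | divides-refl q = minimal P B (positive-factor p (positive P)) (n<p*n (positive-factor p (positive P)))
                               (pow-p-reflects-fixed Cᴮ≈I n v (≡ᵛ-trans (≡ᵛ-reflexive (sym (pow-* C p B v))) Cᵀv≡v))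
        where
        0<q : 0 < q
        0<q = n≢0⇒n>0 λ { refl → <-irrefl refl 0<i }
        q<p : q < p
        q<p = *-cancelʳ-< T q p i<pT
        p∤q : ¬ ℤ.+ p ∣ℤ ℤ.+ q
        p∤q p∣q = <⇒≱ q<p (∣⇒≤ {{>-nonZero 0<q}} (∣ℤ⇒∣ p∣q))
        qx≡0 : (ℤ.+ q) • x ≡ᵛ 0ᵛ [mod p ^ suc n ]
        qx≡0 = ≡ᵛ-trans (≡ᵛ-sym (pow-displacement (pow C T) Cᵀ≈I v pⁿ∣x q))
                         (∣ᵛ⇒≡ᵛ0 (≡ᵛ⇒∣ᵛ- (≡ᵛ-trans (≡ᵛ-reflexive (sym (pow-* C q T v))) fixed)))
        Cᵀv≡v : pow C T · v ≡ᵛ v [mod p ^ suc n ]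
        Cᵀv≡v = ∣ᵛ-⇒≡ᵛ (prime-*-•-cancel pp (p ^ n) (ℤ.+ q) {{p^-nonZero n}} p∤q pⁿ∣x (≡ᵛ0⇒∣ᵛ qx≡0))

    lifted-period-∣ : ∀ {n v T L} → ExactPeriod C (p ^ suc n) v (p * T) →
                      pow C L ≈ I [mod p ] → pow C L · v ≡ᵛ v [mod p ^ n ] → T ∣ L
    lifted-period-∣ {v = v} {L = L} Q Cᴸ≈I fixed = *-cancelˡ-∣ p (period-∣ Q
      (≡ᵛ-trans (≡ᵛ-reflexive (pow-* C p L v))
                (pow-lifts-fixed (pow C L) Cᴸ≈I fixed)))

    module _ (det≡1 : det C ≡ 1ℤ) {u : V} (prim : Primitive p u) where

      fixes-primitive⇒pow-p*≈I : ∀ e t → pow C (p ^ e * t) · u ≡ᵛ u [mod p ] → pow C (p * t) ≈ I [mod p ]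
      fixes-primitive⇒pow-p*≈I e t fixed z =
        ≡ᵛ-trans (≡ᵛ-reflexive (pow-* C p t z))
          (fixes-primitive⇒pow-p≈I pp (pow C t) (det-pow C t det≡1) prim e
            (≡ᵛ-trans (≡ᵛ-reflexive (sym (pow-* C (p ^ e) t u))) fixed) z)

      fixes-primitive⇒pow-≈I-mod-p² : ∀ e s → pow C (p ^ e * s) · u ≡ᵛ u [mod p ] →
                                      pow C (p ^ p * s) ≈ I [mod p * p ]
      fixes-primitive⇒pow-≈I-mod-p² e s fixed z = begin
        pow C (p ^ p * s) · z                    ≡⟨ cong (λ k → pow C k · z) pᵖs≡ ⟩
        pow C (p ^ r * (p * (p * s))) · z        ≡⟨ pow-* C (p ^ r) (p * (p * s)) z ⟩
        pow (pow C (p * (p * s))) (p ^ r) · z    ≈⟨ pow-≈I Cᵖᵖˢ≈I (p ^ r) z ⟩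
        I · z                                    ∎
        where
        open ≈-Reasoning (≡ᵛ-setoid (p * p))
        r = p ∸ 2
        regroup : ∀ p pʳ s → p * (p * pʳ) * s ≡ pʳ * (p * (p * s))
        regroup = solve-∀
        pᵖs≡ : p ^ p * s ≡ p ^ r * (p * (p * s))
        pᵖs≡ = trans (cong (λ e → p ^ e * s) (sym (m+[n∸m]≡n p>1))) (regroup p (p ^ r) s)
        Cᵖˢ≈I = fixes-primitive⇒pow-p*≈I e s fixed
        Cᵖᵖˢ≈I : pow C (p * (p * s)) ≈ I [mod p * p ]
        Cᵖᵖˢ≈I w = ≡ᵛ-trans (≡ᵛ-reflexive (pow-* C p (p * s) w))
                     (≡ᵛ-trans (pow-lifts-fixed (pow C (p * s)) Cᵖˢ≈I (≡ᵛ-trans (Cᵖˢ≈I w) (≡ᵛ-reflexive (I-· w))))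
                               (≡ᵛ-reflexive (sym (I-· w))))

      -- The period T′ modulo pⁿ is divisible by p (lifted-period-∣ with L = T′·B), so C^T′ ≡ I (mod p)
      -- and T ∣ T′; then period-lift makes p·T′ the period modulo pⁿ⁺¹, forcing T′ = T.
      period-descend : ∀ {B n} → pow C B ≈ I [mod p * p ] →
                       ExactPeriod C (p ^ suc n) u (p * (p * B)) → ExactPeriod C (p ^ n) u (p * B)
      period-descend {B} {zero} Cᴮ≈I Q = ⊥-elim (minimal Q B 0<B (<-trans (n<p*n 0<B) (n<p*n 0<pB)) Cᴮu≡u)
        where
        0<pB = positive-factor p (positive Q)
        0<B = positive-factor p 0<pB
        Cᴮu≡u : pow C B · u ≡ᵛ u [mod p * 1 ]
        Cᴮu≡u = subst (λ q → pow C B · u ≡ᵛ u [mod q ]) (sym (*-identityʳ p))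
                      (≡ᵛ-trans (≡ᵛ-weakenˡ p p (Cᴮ≈I u)) (≡ᵛ-reflexive (I-· u)))
      period-descend {B} {suc n} Cᴮ≈I Q
        with period-exists (positive Q) (≡ᵛ-weakenʳ p (p ^ suc n) (returns Q))
      ... | T′ , P′ = subst (ExactPeriod C (p ^ suc n) u) T′≡pB P′
        where
        0<B = positive-factor p (positive-factor p (positive Q))
        Cᴮ≈I-mod-p : pow C B ≈ I [mod p ]
        Cᴮ≈I-mod-p z = ≡ᵛ-weakenˡ p p (Cᴮ≈I z)
        p∣T′ : p ∣ T′
        p∣T′ = *-cancelʳ-∣ B {{>-nonZero 0<B}} (lifted-period-∣ {n = suc n} Q
          (λ z → ≡ᵛ-trans (≡ᵛ-reflexive (pow-* C T′ B z)) (pow-≈I Cᴮ≈I-mod-p T′ z))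
          (≡ᵛ-trans (≡ᵛ-reflexive (cong (λ k → pow C k · u) (*-comm T′ B))) (pow-*-fixed (returns P′) B)))
        Cᵀ′≈I : pow C T′ ≈ I [mod p ]
        Cᵀ′≈I = subst (λ k → pow C k ≈ I [mod p ]) pt≡T′
          (fixes-primitive⇒pow-p*≈I 1 t (≡ᵛ-trans (≡ᵛ-reflexive (cong (λ k → pow C k · u) p¹t≡T′))
                                                  (≡ᵛ-weakenˡ p (p ^ n) (returns P′))))
          where
          t = quotient p∣T′
          pt≡T′ : p * t ≡ T′
          pt≡T′ = trans (*-comm p t) (sym (m∣n⇒n≡quotient*m p∣T′))
          p¹t≡T′ : p ^ 1 * t ≡ T′
          p¹t≡T′ = trans (cong (_* t) (*-identityʳ p)) pt≡T′
        T′≡pB : T′ ≡ p * B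
        T′≡pB = trans T′≡pdB (cong (p *_) (*-cancelˡ-≡ _ _ p (*-cancelˡ-≡ _ _ p (period-unique Q′ Q))))
          where
          pB∣T′ = lifted-period-∣ {n = suc n} Q Cᵀ′≈I (returns P′)
          d = quotient pB∣T′
          reassoc : ∀ d p B → d * (p * B) ≡ p * (d * B)
          reassoc = solve-∀
          T′≡pdB : T′ ≡ p * (d * B)
          T′≡pdB = trans (m∣n⇒n≡quotient*m pB∣T′) (reassoc d p B)
          Cᵈᴮ≈I : pow C (d * B) ≈ I [mod p * p ]
          Cᵈᴮ≈I z = ≡ᵛ-trans (≡ᵛ-reflexive (pow-* C d B z)) (pow-≈I Cᴮ≈I d z)
          Q′ : ExactPeriod C (p ^ suc (suc n)) u (p * (p * (d * B)))
          Q′ = period-lift {n = suc n} Cᵈᴮ≈I (subst (ExactPeriod C (p ^ suc n) u) T′≡pdB P′)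

      primitive-period-lift-iff : ∀ {s} n → 0 < s →
        ExactPeriod C (p ^ n) u (p * (p ^ p * s)) ⇔ ExactPeriod C (p ^ suc n) u (p * (p * (p ^ p * s)))
      primitive-period-lift-iff {s} n 0<s = mk⇔ (lift n) descend
        where
        T = p * (p ^ p * s)
        T≢1 : T ≢ 1
        T≢1 T≡1 = <-irrefl (sym T≡1)
          (<-≤-trans p>1 (m≤m*n p (p ^ p * s) {{m*n≢0 (p ^ p) s {{p^-nonZero p}} {{>-nonZero 0<s}}}}))
        lift : ∀ n → ExactPeriod C (p ^ n) u T → ExactPeriod C (p ^ suc n) u (p * T)
        lift zero     P = ⊥-elim (T≢1 (period-mod-1 P))
        lift (suc n′) P = period-lift {n = suc n′} (fixes-primitive⇒pow-≈I-mod-p² (suc p) s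
          (≡ᵛ-trans (≡ᵛ-reflexive (cong (λ k → pow C k · u) (*-assoc p (p ^ p) s)))
                    (≡ᵛ-weakenˡ p (p ^ n′) (returns P)))) P
        descend : ExactPeriod C (p ^ suc n) u (p * T) → ExactPeriod C (p ^ n) u T
        descend Q = period-descend {n = n} (fixes-primitive⇒pow-≈I-mod-p² (suc (suc p)) s
          (≡ᵛ-trans (≡ᵛ-reflexive (cong (λ k → pow C k · u) (reassoc p (p ^ p) s)))
                    (≡ᵛ-weakenˡ p (p ^ n) (returns Q)))) Q
          where
          reassoc : ∀ p pᵖ s → p * (p * pᵖ) * s ≡ p * (p * (pᵖ * s))
          reassoc = solve-∀

    period-rescale-iff : ∀ m {q q′ u T} .{{_ : NonZero m}} → q′ ≡ m * q →
                         ExactPeriod C q′ ((ℤ.+ m) • u) T ⇔ ExactPeriod C q u T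
    period-rescale-iff m refl = mk⇔ (period-•-cancel m) (period-•-mono m)

    period-lift-iff : det C ≡ 1ℤ → ∀ {s} → 0 < s → ∀ k w →
      ExactPeriod C (p ^ k) w (p * (p ^ p * s)) ⇔ ExactPeriod C (p ^ suc k) w (p * (p * (p ^ p * s)))
    period-lift-iff det≡1 {s} 0<s k w with primitive-decomposition (suc k) w
    ... | inj₁ pᵏ⁺¹∣w = mk⇔
      (λ P → ⊥-elim (≢1 1<T (period-of-multiple (∣ᵛ-weakenʳ p (p ^ k) pᵏ⁺¹∣w) P)))
      (λ Q → ⊥-elim (≢1 (<-trans 1<T (n<p*n (<-trans (s≤s z≤n) 1<T))) (period-of-multiple pᵏ⁺¹∣w Q)))
      where
      0<pᵖs : 0 < p ^ p * s
      0<pᵖs = >-nonZero⁻¹ _ {{m*n≢0 (p ^ p) s {{p^-nonZero p}} {{>-nonZero 0<s}}}}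
      1<T : 1 < p * (p ^ p * s)
      1<T = ≤-<-trans 0<pᵖs (n<p*n 0<pᵖs)
      ≢1 : ∀ {T} → 1 < T → T ≢ 1
      ≢1 1<T refl = <-irrefl refl 1<T
    ... | inj₂ (j , u , s≤s j≤k , prim , refl) =
      ⇔.trans (period-rescale-iff (p ^ j) {{p^-nonZero j}} splitₖ)
        (⇔.trans (primitive-period-lift-iff det≡1 prim (k ∸ j) 0<s)
          (⇔.sym (period-rescale-iff (p ^ j) {{p^-nonZero j}} split₁₊ₖ)))
      where
      splitₖ : p ^ k ≡ p ^ j * p ^ (k ∸ j)
      splitₖ = trans (cong (p ^_) (sym (m+[n∸m]≡n j≤k))) (^-distribˡ-+-* p j (k ∸ j))
      split₁₊ₖ : p ^ suc k ≡ p ^ j * p ^ suc (k ∸ j)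
      split₁₊ₖ = trans (cong (p *_) splitₖ) (swap p (p ^ j) (p ^ (k ∸ j)))
        where
        swap : ∀ p a b → p * (a * b) ≡ a * (p * b)
        swap = solve-∀

IsTrue-not⇒¬ : ∀ {b} → IsTrue (not b) → ¬ IsTrue b
IsTrue-not⇒¬ {false} _ ()

¬⇒IsTrue-not : ∀ {b} → ¬ IsTrue b → IsTrue (not b)
¬⇒IsTrue-not {false} _ = _
¬⇒IsTrue-not {true}  ¬b = ¬b _

InRange : ℕ → Pt → Set
InRange m (x , y) = x < m × y < m

ptEq⇒≡ : ∀ P Q → IsTrue (ptEq P Q) → P ≡ Q
ptEq⇒≡ (x , y) (u , v) eq with Equivalence.to T-∧ eq
... | x≡u , y≡v = cong₂ _,_ (≡ᵇ⇒≡ x u x≡u) (≡ᵇ⇒≡ y v y≡v)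

≡⇒ptEq : ∀ P Q → P ≡ Q → IsTrue (ptEq P Q)
≡⇒ptEq (x , y) _ refl = Equivalence.from T-∧ (≡⇒≡ᵇ x x refl , ≡⇒≡ᵇ y y refl)

allBelow⁻ : ∀ n P → IsTrue (allBelow n P) → ∀ i → i < n → IsTrue (P i)
allBelow⁻ (suc n) P all i i<1+n with Equivalence.to T-∧ all | m≤n⇒m<n∨m≡n (≤-pred i<1+n)
... | below , _ | inj₁ i<n  = allBelow⁻ n P below i i<n
... | _ , Pn    | inj₂ refl = Pn

allBelow⁺ : ∀ n P → (∀ i → i < n → IsTrue (P i)) → IsTrue (allBelow n P)
allBelow⁺ zero    P _   = _
allBelow⁺ (suc n) P all =
  Equivalence.from T-∧ (allBelow⁺ n P (λ i i<n → all i (m<n⇒m<1+n i<n)) , all n (n<1+n n))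

toℤ²-injective : ∀ {m P Q} → InRange m P → InRange m Q → toℤ² P ≡ᵛ toℤ² Q [mod m ] → P ≡ Q
toℤ²-injective (x<m , y<m) (u<m , v<m) (x≡u , y≡v) = cong₂ _,_ (≡-mod⇒≡ x<m u<m x≡u) (≡-mod⇒≡ y<m v<m y≡v)

module CatMapOrbits (m : ℕ) {{_ : NonZero m}} (a b : ℤ) where

  f : Pt → Pt
  f = catMap m a b

  C : Mat
  C = catMatrix a b

  iter-inRange : ∀ n P → InRange m P → InRange m (iter f n P)
  iter-inRange zero    P inRange = inRange
  iter-inRange (suc n) P _       = m%n<n _ m , m%n<n _ m

  iter-≡ᵛ : ∀ n P → toℤ² (iter f n P) ≡ᵛ pow C n · toℤ² P [mod m ]
  iter-≡ᵛ zero    P = ≡ᵛ-reflexive (sym (I-· (toℤ² P)))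
  iter-≡ᵛ (suc n) P = ≡ᵛ-trans (catMap-≡ᵛ m a b (iter f n P))
    (≡ᵛ-trans (·-cong C (iter-≡ᵛ n P)) (≡ᵛ-reflexive (sym (·-⊗ C (pow C n) (toℤ² P)))))

  iter-returns⇔ : ∀ n {P} → InRange m P → IsTrue (ptEq (iter f n P) P) ⇔ pow C n · toℤ² P ≡ᵛ toℤ² P [mod m ]
  iter-returns⇔ n {P} inRange = mk⇔
    (λ returns → ≡ᵛ-trans (≡ᵛ-sym (iter-≡ᵛ n P)) (≡ᵛ-reflexive (cong toℤ² (ptEq⇒≡ _ _ returns))))
    (λ fixed → ≡⇒ptEq _ _ (toℤ²-injective (iter-inRange n P inRange) inRange (≡ᵛ-trans (iter-≡ᵛ n P) fixed)))

  onCycle⇔period : ∀ T {P} → InRange m P → IsTrue (onCycleOfLength f T P) ⇔ ExactPeriod C m (toℤ² P) T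
  onCycle⇔period zero    inRange = mk⇔ (λ ()) (λ P → ⊥-elim (<-irrefl refl (positive P)))
  onCycle⇔period (suc t) {P} inRange = mk⇔ to from
    where
    returns⇔ : ∀ n → IsTrue (ptEq (iter f n P) P) ⇔ pow C n · toℤ² P ≡ᵛ toℤ² P [mod m ]
    returns⇔ n = iter-returns⇔ n inRange
    to : IsTrue (onCycleOfLength f (suc t) P) → ExactPeriod C m (toℤ² P) (suc t)
    to onCycle with Equivalence.to T-∧ onCycle
    ... | returns , not-earlier = record
      { positive = s≤s z≤n
      ; returns  = Equivalence.to (returns⇔ (suc t)) returns
      ; minimal  = λ { (suc i) _ (s≤s i<t) fixed →
          IsTrue-not⇒¬ (allBelow⁻ t _ not-earlier i i<t) (Equivalence.from (returns⇔ (suc i)) fixed) }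
      }
    from : ExactPeriod C m (toℤ² P) (suc t) → IsTrue (onCycleOfLength f (suc t) P)
    from period = Equivalence.from T-∧ (Equivalence.from (returns⇔ (suc t)) (returns period) ,
      allBelow⁺ t _ (λ i i<t → ¬⇒IsTrue-not λ returns →
        minimal period (suc i) (s≤s z≤n) (s≤s i<t) (Equivalence.to (returns⇔ (suc i)) returns)))

-- Counting points

toℕ : Bool → ℕ
toℕ true  = 1
toℕ false = 0

toℕ-true : ∀ {b} → IsTrue b → toℕ b ≡ 1
toℕ-true {true} _ = refl

toℕ-false : ∀ {b} → ¬ IsTrue b → toℕ b ≡ 0
toℕ-false {false} _   = refl
toℕ-false {true}  ¬b = ⊥-elim (¬b _)

toℕ*≡0 : ∀ b {n} → (IsTrue b → n ≡ 0) → toℕ b * n ≡ 0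
toℕ*≡0 false _   = refl
toℕ*≡0 true  n≡0 = trans (+-identityʳ _) (n≡0 _)

∑ : ℕ → (ℕ → ℕ) → ℕ
∑ zero    g = 0
∑ (suc n) g = g 0 + ∑ n (λ i → g (suc i))

∑-cong : ∀ n {g h} → (∀ i → i < n → g i ≡ h i) → ∑ n g ≡ ∑ n h
∑-cong zero    _   = refl
∑-cong (suc n) g≗h = cong₂ _+_ (g≗h 0 (s≤s z≤n)) (∑-cong n (λ i i<n → g≗h (suc i) (s≤s i<n)))

∑-distrib-+ : ∀ n g h → ∑ n (λ i → g i + h i) ≡ ∑ n g + ∑ n h
∑-distrib-+ zero    g h = refl
∑-distrib-+ (suc n) g h = trans (cong (g 0 + h 0 +_) (∑-distrib-+ n _ _)) (interchange (g 0) (h 0) _ _)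
  where
  interchange : ∀ a b c d → a + b + (c + d) ≡ a + c + (b + d)
  interchange = solve-∀

∑-*ˡ : ∀ n c g → ∑ n (λ i → c * g i) ≡ c * ∑ n g
∑-*ˡ zero    c g = sym (*-zeroʳ c)
∑-*ˡ (suc n) c g = trans (cong (c * g 0 +_) (∑-*ˡ n c _)) (sym (*-distribˡ-+ c (g 0) _))

∑-const : ∀ n c → ∑ n (λ _ → c) ≡ n * c
∑-const zero    c = refl
∑-const (suc n) c = cong (c +_) (∑-const n c)

∑-zero : ∀ n g → (∀ i → i < n → g i ≡ 0) → ∑ n g ≡ 0
∑-zero n g g≡0 = trans (∑-cong n g≡0) (trans (∑-const n 0) (*-zeroʳ n))

∑-comm : ∀ n m (g : ℕ → ℕ → ℕ) → ∑ n (λ i → ∑ m (g i)) ≡ ∑ m (λ j → ∑ n (λ i → g i j))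
∑-comm zero    m g = sym (∑-zero m _ (λ _ _ → refl))
∑-comm (suc n) m g = trans (cong (∑ m (g 0) +_) (∑-comm n m (λ i → g (suc i))))
                           (sym (∑-distrib-+ m (g 0) (λ j → ∑ n (λ i → g (suc i) j))))

∑-single : ∀ n g {i₀} → i₀ < n → (∀ i → i < n → i ≢ i₀ → g i ≡ 0) → ∑ n g ≡ g i₀
∑-single (suc n) g {zero}   _          off =
  trans (cong (g 0 +_) (∑-zero n _ (λ i i<n → off (suc i) (s≤s i<n) λ ()))) (+-identityʳ (g 0))
∑-single (suc n) g {suc i₀} (s≤s i₀<n) off =
  trans (cong (_+ ∑ n (λ i → g (suc i))) (off 0 (s≤s z≤n) λ ()))
        (∑-single n (λ i → g (suc i)) i₀<n (λ i i<n i≢i₀ → off (suc i) (s≤s i<n) (λ { refl → i≢i₀ refl })))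

∑-split : ∀ a b g → ∑ (a + b) g ≡ ∑ a g + ∑ b (λ i → g (a + i))
∑-split zero    b g = refl
∑-split (suc a) b g = trans (cong (g 0 +_) (∑-split a b (λ i → g (suc i)))) (sym (+-assoc (g 0) _ _))

∑-mod : ∀ q m {{_ : NonZero m}} g → ∑ (q * m) (λ i → g (i % m)) ≡ q * ∑ m g
∑-mod zero    m g = refl
∑-mod (suc q) m g = trans (∑-split m (q * m) (λ i → g (i % m))) (cong₂ _+_
  (∑-cong m (λ i i<m → cong g (m<n⇒m%n≡m i<m)))
  (trans (∑-cong (q * m) (λ i _ → cong g (trans (cong (_% m) (+-comm m i)) ([m+n]%n≡m%n i m)))) (∑-mod q m g)))

∑² : ℕ → (Pt → ℕ) → ℕ
∑² m g = ∑ m (λ x → ∑ m (λ y → g (x , y)))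

∑²-cong : ∀ m {g h} → (∀ P → InRange m P → g P ≡ h P) → ∑² m g ≡ ∑² m h
∑²-cong m g≗h = ∑-cong m (λ x x<m → ∑-cong m (λ y y<m → g≗h (x , y) (x<m , y<m)))

∑²-*ˡ : ∀ m c g → ∑² m (λ P → c * g P) ≡ c * ∑² m g
∑²-*ˡ m c g = trans (∑-cong m (λ x _ → ∑-*ˡ m c (λ y → g (x , y)))) (∑-*ˡ m c _)

∑²-∑ : ∀ m n (g : ℕ → Pt → ℕ) → ∑² m (λ P → ∑ n (λ i → g i P)) ≡ ∑ n (λ i → ∑² m (g i))
∑²-∑ m n g = trans (∑-cong m (λ x _ → ∑-comm m n (λ y i → g i (x , y))))
                   (∑-comm m n (λ x i → ∑ m (λ y → g i (x , y))))

∑²-comm : ∀ m (h : Pt → Pt → ℕ) → ∑² m (λ P → ∑² m (h P)) ≡ ∑² m (λ Q → ∑² m (λ P → h P Q))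
∑²-comm m h = trans (∑²-∑ m m (λ x P → ∑ m (λ y → h P (x , y))))
                    (∑-cong m (λ x _ → ∑²-∑ m m (λ y P → h P (x , y))))

∑²-zero : ∀ m g → (∀ P → InRange m P → g P ≡ 0) → ∑² m g ≡ 0
∑²-zero m g g≡0 = trans (∑²-cong m g≡0) (∑-zero m _ (λ x _ → ∑-zero m _ (λ _ _ → refl)))

∑²-single : ∀ m g {P₀} → InRange m P₀ → (∀ P → InRange m P → P ≢ P₀ → g P ≡ 0) → ∑² m g ≡ g P₀
∑²-single m g {x₀ , y₀} (x₀<m , y₀<m) off =
  trans (∑-single m _ x₀<m (λ x x<m x≢x₀ → ∑-zero m _ (λ y y<m → off (x , y) (x<m , y<m) (x≢x₀ ∘ cong proj₁))))
        (∑-single m _ y₀<m (λ y y<m y≢y₀ → off (x₀ , y) (x₀<m , y<m) (y≢y₀ ∘ cong proj₂)))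

red : (m : ℕ) {{_ : NonZero m}} → Pt → Pt
red m (x , y) = (x % m , y % m)

∑²-red : ∀ q m {{_ : NonZero m}} g → ∑² (q * m) (λ P → g (red m P)) ≡ (q * q) * ∑² m g
∑²-red q m g = begin
  ∑² (q * m) (λ P → g (red m P))              ≡⟨ ∑-cong (q * m) (λ x _ → ∑-mod q m (λ y → g (x % m , y))) ⟩
  ∑ (q * m) (λ x → q * ∑ m (λ y → g (x % m , y)))  ≡⟨ ∑-*ˡ (q * m) q _ ⟩
  q * ∑ (q * m) (λ x → ∑ m (λ y → g (x % m , y)))  ≡⟨ cong (q *_) (∑-mod q m (λ x → ∑ m (λ y → g (x , y)))) ⟩
  q * (q * ∑² m g)                             ≡⟨ *-assoc q q _ ⟨
  (q * q) * ∑² m g                             ∎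
  where open ≡-Reasoning

count-points : ∀ m (b : Pt → Bool) → length (filterᵇ b (points m)) ≡ ∑² m (λ P → toℕ (b P))
count-points m b = begin
  length (filterᵇ b (points m))                                     ≡⟨ length-filterᵇ b (points m) ⟩
  sum (map (toℕ ∘ b) (points m))                                    ≡⟨ sum-map-concatMap (toℕ ∘ b) row (upTo m) ⟩
  sum (map (λ x → sum (map (toℕ ∘ b) (row x))) (upTo m))            ≡⟨ sum-map-upTo m _ ⟩
  ∑ m (λ x → sum (map (toℕ ∘ b) (row x)))                          ≡⟨ ∑-cong m (λ x _ →
                                                                        trans (cong sum (sym (map-∘ (upTo m))))
                                                                              (sum-map-upTo m _)) ⟩
  ∑² m (λ P → toℕ (b P))                                            ∎
  where
  open ≡-Reasoning
  row : ℕ → List Pt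
  row x = map (x ,_) (upTo m)
  length-filterᵇ : ∀ {A : Set} (b : A → Bool) xs → length (filterᵇ b xs) ≡ sum (map (toℕ ∘ b) xs)
  length-filterᵇ b []       = refl
  length-filterᵇ b (x ∷ xs) with b x
  ... | true  = cong suc (length-filterᵇ b xs)
  ... | false = length-filterᵇ b xs
  sum-map-concatMap : ∀ {A B : Set} (g : B → ℕ) (h : A → List B) xs →
                      sum (map g (concatMap h xs)) ≡ sum (map (λ x → sum (map g (h x))) xs)
  sum-map-concatMap g h []       = refl
  sum-map-concatMap g h (x ∷ xs) = trans (cong sum (map-++ g (h x) (concatMap h xs)))
    (trans (sum-++ (map g (h x)) _) (cong (sum (map g (h x)) +_) (sum-map-concatMap g h xs)))
  sum-map-upTo : ∀ n (g : ℕ → ℕ) → sum (map g (upTo n)) ≡ ∑ n g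
  sum-map-upTo n g = go n (λ i → i)
    where
    go : ∀ n (s : ℕ → ℕ) → sum (map g (applyUpTo s n)) ≡ ∑ n (g ∘ s)
    go zero    s = refl
    go (suc n) s = cong (g (s 0) +_) (go n (s ∘ suc))

argmin : ∀ n (g : ℕ → ℕ) → 0 < n → ∃ λ i₀ → i₀ < n × (∀ i → i < n → g i₀ ≤ g i)
argmin (suc zero)    g _ = 0 , s≤s z≤n , λ { zero _ → ≤-refl ; (suc i) (s≤s ()) }
argmin (suc (suc n)) g _ with argmin (suc n) g (s≤s z≤n)
... | i₀ , i₀<1+n , least with ≤-total (g i₀) (g (suc n))
...   | inj₁ gi₀≤ = i₀ , m<n⇒m<1+n i₀<1+n , λ i i<2+n → case-last i i<2+n (least i) gi₀≤
  where
  case-last : ∀ i → i < suc (suc n) → (i < suc n → g i₀ ≤ g i) → g i₀ ≤ g (suc n) → g i₀ ≤ g i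
  case-last i i<2+n below last with m≤n⇒m<n∨m≡n (≤-pred i<2+n)
  ... | inj₁ i<1+n = below i<1+n
  ... | inj₂ refl  = last
...   | inj₂ g1+n≤ = suc n , n<1+n (suc n) , λ i i<2+n → case-last i i<2+n
  where
  case-last : ∀ i → i < suc (suc n) → g (suc n) ≤ g i
  case-last i i<2+n with m≤n⇒m<n∨m≡n (≤-pred i<2+n)
  ... | inj₁ i<1+n = ≤-trans g1+n≤ (least i i<1+n)
  ... | inj₂ refl  = ≤-refl

code-injective : ∀ m {{_ : NonZero m}} {P Q} → InRange m P → InRange m Q → code m P ≡ code m Q → P ≡ Q
code-injective m {x , y} {u , v} (_ , y<m) (_ , v<m) eq = cong₂ _,_ x≡u y≡v
  where
  code%m : ∀ x y → y < m → (x * m + y) % m ≡ y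
  code%m x y y<m = trans (cong (_% m) (+-comm (x * m) y)) (trans ([m+kn]%n≡m%n y x m) (m<n⇒m%n≡m y<m))
  y≡v : y ≡ v
  y≡v = trans (sym (code%m x y y<m)) (trans (cong (_% m) eq) (code%m u v v<m))
  x≡u : x ≡ u
  x≡u = *-cancelʳ-≡ x u m (+-cancelʳ-≡ y (x * m) (u * m) (trans eq (cong (u * m +_) (sym y≡v))))

iter-+ : ∀ (f : Pt → Pt) i j x → iter f (i + j) x ≡ iter f i (iter f j x)
iter-+ f zero    j x = refl
iter-+ f (suc i) j x = cong f (iter-+ f i j x)

iter-*-period : ∀ f {T x} → iter f T x ≡ x → ∀ k → iter f (k * T) x ≡ x
iter-*-period f         fixed zero    = refl
iter-*-period f {T} {x} fixed (suc k) = trans (iter-+ f T (k * T) x)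
  (trans (cong (iter f T) (iter-*-period f fixed k)) fixed)

iter-mod : ∀ f {T x} {{_ : NonZero T}} → iter f T x ≡ x → ∀ n → iter f n x ≡ iter f (n % T) x
iter-mod f {T} {x} fixed n = begin
  iter f n x                            ≡⟨ cong (λ k → iter f k x) (m≡m%n+[m/n]*n n T) ⟩
  iter f (n % T + (n / T) * T) x        ≡⟨ iter-+ f (n % T) _ x ⟩
  iter f (n % T) (iter f ((n / T) * T) x) ≡⟨ cong (iter f (n % T)) (iter-*-period f fixed (n / T)) ⟩
  iter f (n % T) x                      ∎
  where open ≡-Reasoning

module CycleCount (m : ℕ) {{_ : NonZero m}} (a b : ℤ) (T : ℕ) {{_ : NonZero T}} where

  open CatMapOrbits m a b

  onCycle : Pt → Bool
  onCycle = onCycleOfLength f T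

  isRep : Pt → Bool
  isRep = isCycleRep m f T

  OnCycle : Pt → Set
  OnCycle x = IsTrue (onCycle x)

  period⇒iter : ∀ {x} → InRange m x → OnCycle x → iter f T x ≡ x
  period⇒iter {x} x∈ on = ptEq⇒≡ _ _ (Equivalence.from (iter-returns⇔ T x∈)
    (returns (Equivalence.to (onCycle⇔period T x∈) on)))

  orbit-onCycle : ∀ {x} → InRange m x → OnCycle x → ∀ i → OnCycle (iter f i x)
  orbit-onCycle {x} x∈ on i = Equivalence.from (onCycle⇔period T (iter-inRange i x x∈))
    (period-respects (≡ᵛ-sym (iter-≡ᵛ i x)) (period-orbit (det-catMatrix a b) (Equivalence.to (onCycle⇔period T x∈) on) i))

  orbit-injective : ∀ {x i j} → InRange m x → OnCycle x → i < T → j < T → iter f i x ≡ iter f j x → i ≡ j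
  orbit-injective {x} {i} {j} x∈ on i<T j<T eq = period-injective (det-catMatrix a b)
    (Equivalence.to (onCycle⇔period T x∈) on) i<T j<T
    (≡ᵛ-trans (≡ᵛ-sym (iter-≡ᵛ i x)) (≡ᵛ-trans (≡ᵛ-reflexive (cong toℤ² eq)) (iter-≡ᵛ j x)))

  orbit-mod : ∀ {x} → InRange m x → OnCycle x → ∀ n → iter f n x ≡ iter f (n % T) x
  orbit-mod x∈ on = iter-mod f {T} (period⇒iter x∈ on)

  return-index : ∀ {x} → InRange m x → OnCycle x → ∀ {i} → i < T → iter f ((T ∸ i) % T) (iter f i x) ≡ x
  return-index {x} x∈ on {i} i<T = begin
    iter f ((T ∸ i) % T) (iter f i x)   ≡⟨ orbit-mod (iter-inRange i x x∈) (orbit-onCycle x∈ on i) (T ∸ i) ⟨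
    iter f (T ∸ i) (iter f i x)         ≡⟨ iter-+ f (T ∸ i) i x ⟨
    iter f (T ∸ i + i) x                ≡⟨ cong (λ k → iter f k x) (m∸n+n≡m (<⇒≤ i<T)) ⟩
    iter f T x                          ≡⟨ period⇒iter x∈ on ⟩
    x                                   ∎
    where open ≡-Reasoning

  isRep⇒onCycle : ∀ {r} → IsTrue (isRep r) → OnCycle r
  isRep⇒onCycle rep = proj₁ (Equivalence.to T-∧ rep)

  isRep⇒least : ∀ {r} → IsTrue (isRep r) → ∀ i → i < T → code m r ≤ code m (iter f i r)
  isRep⇒least rep i i<T = ≤ᵇ⇒≤ _ _ (allBelow⁻ T _ (proj₂ (Equivalence.to T-∧ rep)) i i<T)

  reps-in-same-orbit : ∀ {r r′ i} → InRange m r → InRange m r′ → IsTrue (isRep r) → IsTrue (isRep r′) →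
                       iter f i r ≡ r′ → r ≡ r′
  reps-in-same-orbit {r} {r′} {i} r∈ r′∈ rep rep′ eq = code-injective m r∈ r′∈ (≤-antisym r≤r′ r′≤r)
    where
    on = isRep⇒onCycle rep
    i%T<T = m%n<n i T
    r≤r′ : code m r ≤ code m r′
    r≤r′ = subst (λ y → code m r ≤ code m y) (trans (sym (orbit-mod r∈ on i)) eq) (isRep⇒least rep (i % T) i%T<T)
    r′≤r : code m r′ ≤ code m r
    r′≤r = subst (λ y → code m r′ ≤ code m y)
      (trans (cong (iter f ((T ∸ i % T) % T)) (trans (sym eq) (orbit-mod r∈ on i))) (return-index r∈ on i%T<T))
      (isRep⇒least rep′ ((T ∸ i % T) % T) (m%n<n (T ∸ i % T) T))

  representative : ∀ {x} → InRange m x → OnCycle x → ∃ λ i₀ → IsTrue (isRep (iter f i₀ x))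
  representative {x} x∈ on with argmin T (λ i → code m (iter f i x)) (>-nonZero⁻¹ T)
  ... | i₀ , _ , least = i₀ , Equivalence.from T-∧ (orbit-onCycle x∈ on i₀ ,
    allBelow⁺ T _ (λ i i<T → ≤⇒≤ᵇ (subst (λ y → code m (iter f i₀ x) ≤ code m y)
      (sym (trans (sym (iter-+ f i i₀ x)) (orbit-mod x∈ on (i + i₀))))
      (least ((i + i₀) % T) (m%n<n (i + i₀) T)))))

  orbit-hits : Pt → Pt → ℕ
  orbit-hits r x = ∑ T (λ i → toℕ (ptEq (iter f i r) x))

  rep-weight : Pt → Pt → ℕ
  rep-weight r x = toℕ (isRep r) * orbit-hits r x

  ∑²-ptEq : ∀ {y} → InRange m y → ∑² m (λ x → toℕ (ptEq y x)) ≡ 1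
  ∑²-ptEq {y} y∈ = trans (∑²-single m _ y∈ (λ x _ x≢y → toℕ-false (x≢y ∘ sym ∘ ptEq⇒≡ y x)))
                         (toℕ-true (≡⇒ptEq y y refl))

  orbit-size : ∀ {r} → InRange m r → ∑² m (orbit-hits r) ≡ T
  orbit-size {r} r∈ = begin
    ∑² m (orbit-hits r)                                  ≡⟨ ∑²-∑ m T (λ i x → toℕ (ptEq (iter f i r) x)) ⟩
    ∑ T (λ i → ∑² m (λ x → toℕ (ptEq (iter f i r) x)))   ≡⟨ ∑-cong T (λ i _ → ∑²-ptEq (iter-inRange i r r∈)) ⟩
    ∑ T (λ _ → 1)                                        ≡⟨ ∑-const T 1 ⟩
    T * 1                                                ≡⟨ *-identityʳ T ⟩
    T                                                    ∎
    where open ≡-Reasoning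

  rep-count-on-cycle : ∀ {x} → InRange m x → OnCycle x → ∑² m (λ r → rep-weight r x) ≡ 1
  rep-count-on-cycle {x} x∈ on = trans (∑²-single m (λ r → rep-weight r x) r₀∈ others)
                                       (cong₂ _*_ (toℕ-true rep₀) hits₀)
    where
    i₀ = proj₁ (representative x∈ on)
    rep₀ : IsTrue (isRep (iter f i₀ x))
    rep₀ = proj₂ (representative x∈ on)
    r₀ = iter f i₀ x
    r₀∈ = iter-inRange i₀ x x∈
    j₀ = (T ∸ i₀ % T) % T
    j₀<T = m%n<n (T ∸ i₀ % T) T
    r₀-returns : iter f j₀ r₀ ≡ x
    r₀-returns = trans (cong (iter f j₀) (orbit-mod x∈ on i₀)) (return-index x∈ on (m%n<n i₀ T))
    hits₀ : orbit-hits r₀ x ≡ 1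
    hits₀ = trans (∑-single T (λ i → toℕ (ptEq (iter f i r₀) x)) j₀<T (λ i i<T i≢j₀ → toℕ-false λ hit → i≢j₀
              (orbit-injective r₀∈ (orbit-onCycle x∈ on i₀) i<T j₀<T (trans (ptEq⇒≡ _ _ hit) (sym r₀-returns)))))
          (toℕ-true (≡⇒ptEq _ _ r₀-returns))
    others : ∀ r → InRange m r → r ≢ r₀ → rep-weight r x ≡ 0
    others r r∈ r≢r₀ = toℕ*≡0 (isRep r) λ rep →
      ∑-zero T (λ i → toℕ (ptEq (iter f i r) x)) (λ i _ → toℕ-false λ hit → r≢r₀
        (reps-in-same-orbit {i = i₀ + i} r∈ r₀∈ rep rep₀ (trans (iter-+ f i₀ i r) (cong (iter f i₀) (ptEq⇒≡ _ _ hit)))))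

  rep-count : ∀ {x} → InRange m x → ∑² m (λ r → rep-weight r x) ≡ toℕ (onCycle x)
  rep-count {x} x∈ with T? (onCycle x)
  ... | yes on = trans (rep-count-on-cycle x∈ on) (sym (toℕ-true on))
  ... | no ¬on = trans (∑²-zero m (λ r → toℕ (isRep r) * orbit-hits r x) off-cycle) (sym (toℕ-false ¬on))
    where
    off-cycle : ∀ r → InRange m r → rep-weight r x ≡ 0
    off-cycle r r∈ = toℕ*≡0 (isRep r) λ rep → ∑-zero T (λ i → toℕ (ptEq (iter f i r) x)) (λ i _ → toℕ-false λ hit →
      ¬on (subst OnCycle (ptEq⇒≡ _ _ hit) (orbit-onCycle r∈ (isRep⇒onCycle rep) i)))

  points-on-cycles : ∑² m (toℕ ∘ onCycle) ≡ T * ∑² m (toℕ ∘ isRep)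
  points-on-cycles = begin
    ∑² m (toℕ ∘ onCycle)                       ≡⟨ ∑²-cong m (λ _ x∈ → rep-count x∈) ⟨
    ∑² m (λ x → ∑² m (λ r → rep-weight r x))   ≡⟨ ∑²-comm m (λ x r → rep-weight r x) ⟩
    ∑² m (λ r → ∑² m (rep-weight r))           ≡⟨ ∑²-cong m (λ r r∈ → weight-sum r∈) ⟩
    ∑² m (λ r → toℕ (isRep r) * T)             ≡⟨ ∑²-cong m (λ r _ → *-comm (toℕ (isRep r)) T) ⟩
    ∑² m (λ r → T * toℕ (isRep r))             ≡⟨ ∑²-*ˡ m T (toℕ ∘ isRep) ⟩
    T * ∑² m (toℕ ∘ isRep)                     ∎
    where
    open ≡-Reasoning
    weight-sum : ∀ {r} → InRange m r → ∑² m (rep-weight r) ≡ toℕ (isRep r) * T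
    weight-sum {r} r∈ = trans (∑²-*ˡ m (toℕ (isRep r)) (orbit-hits r)) (cong (toℕ (isRep r) *_) (orbit-size r∈))

-- Cycles modulo pᵏ and pᵏ⁺¹

IsTrue-⇔⇒≡ : ∀ {b c} → IsTrue b ⇔ IsTrue c → b ≡ c
IsTrue-⇔⇒≡ {false} {false} _   = refl
IsTrue-⇔⇒≡ {false} {true}  b⇔c = ⊥-elim (Equivalence.from b⇔c _)
IsTrue-⇔⇒≡ {true}  {false} b⇔c = ⊥-elim (Equivalence.to b⇔c _)
IsTrue-⇔⇒≡ {true}  {true}  _   = refl

module _ {p : ℕ} (pp : Prime p) where

  n<p^n : ∀ n → n < p ^ n
  n<p^n zero    = s≤s z≤n
  n<p^n (suc n) = <-≤-trans (s≤s (n<p^n n)) (n<p*n pp (<-≤-trans (s≤s z≤n) (n<p^n n)))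

  valuation>p⇒p^[1+p]∣ : ∀ {T} → 0 < T → (∀ e → IsValuation p T e → p < e) → p ^ suc p ∣ T
  valuation>p⇒p^[1+p]∣ {T} 0<T ν>p
    with least-witness (λ e → ¬ p ^ suc e ∣ T) (λ e → ¬? (p ^ suc e ∣? T)) {T} ¬p^[1+T]∣T
    where
    ¬p^[1+T]∣T : ¬ p ^ suc T ∣ T
    ¬p^[1+T]∣T p^[1+T]∣T = <⇒≱ (n<p^n (suc T)) (≤-trans (∣⇒≤ {{>-nonZero 0<T}} p^[1+T]∣T) (n≤1+n T))
  ... | e , ¬p^[1+e]∣T , below = ∣-trans p^[1+p]∣p^e p^e∣T
    where
    divides-up-to : ∀ e → (∀ i → i < e → ¬ ¬ p ^ suc i ∣ T) → p ^ e ∣ T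
    divides-up-to zero     _     = 1∣ T
    divides-up-to (suc e′) below = decidable-stable (p ^ suc e′ ∣? T) (below e′ (n<1+n e′))
    p^e∣T : p ^ e ∣ T
    p^e∣T = divides-up-to e below
    p<e : p < e
    p<e = ν>p e (p^e∣T , ¬p^[1+e]∣T)
    p^[1+p]∣p^e : p ^ suc p ∣ p ^ e
    p^[1+p]∣p^e = subst (p ^ suc p ∣_)
      (trans (sym (^-distribˡ-+-* p (suc p) (e ∸ suc p))) (cong (p ^_) (m+[n∸m]≡n p<e)))
      (m∣m*n (p ^ (e ∸ suc p)))

  module _ (a b : ℤ) {s : ℕ} (0<s : 0 < s) (k : ℕ) where

    private
      T = p * (p ^ p * s)
      instance
        pᵏ-nonZero : NonZero (p ^ k)
        pᵏ-nonZero = p^-nonZero pp k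
        p¹⁺ᵏ-nonZero : NonZero (p ^ suc k)
        p¹⁺ᵏ-nonZero = p^-nonZero pp (suc k)
        T-nonZero : NonZero T
        T-nonZero = m*n≢0 p (p ^ p * s) {{p-nonZero pp}}
                          {{m*n≢0 (p ^ p) s {{p^-nonZero pp p}} {{>-nonZero 0<s}}}}
        pT-nonZero : NonZero (p * T)
        pT-nonZero = m*n≢0 p T {{p-nonZero pp}}

    onCycle-lift : ∀ {P} → InRange (p ^ suc k) P →
                   onCycleOfLength (catMap (p ^ suc k) a b) (p * T) P
                   ≡ onCycleOfLength (catMap (p ^ k) a b) T (red (p ^ k) P)
    onCycle-lift {x , y} P∈ = IsTrue-⇔⇒≡ (
      ⇔.trans (CatMapOrbits.onCycle⇔period (p ^ suc k) a b (p * T) P∈)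
      (⇔.trans (⇔.sym (period-lift-iff pp {C = catMatrix a b} (det-catMatrix a b) 0<s k (toℤ² (x , y))))
      (⇔.trans (mk⇔ (period-respects (≡ᵛ-sym reduce)) (period-respects reduce))
               (⇔.sym (CatMapOrbits.onCycle⇔period (p ^ k) a b T (m%n<n x (p ^ k) , m%n<n y (p ^ k)))))))
      where
      reduce : toℤ² (red (p ^ k) (x , y)) ≡ᵛ toℤ² (x , y) [mod p ^ k ]
      reduce = ≡-%ℕ (ℤ.+ x) (p ^ k) , ≡-%ℕ (ℤ.+ y) (p ^ k)

    cycle-count-lift : p * N p {{p-nonZero pp}} a b T k ≡ N p {{p-nonZero pp}} a b (p * T) (suc k)
    cycle-count-lift = *-cancelˡ-≡ _ _ (p * T) (begin
      (p * T) * (p * N₁)                            ≡⟨ rearrange p T N₁ ⟩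
      (p * p) * (T * N₁)                            ≡⟨ cong (λ n → (p * p) * (T * n)) (count-points m isRep₁) ⟩
      (p * p) * (T * ∑² m (toℕ ∘ isRep₁))           ≡⟨ cong ((p * p) *_) Count₁.points-on-cycles ⟨
      (p * p) * ∑² m (toℕ ∘ onCycle₁)               ≡⟨ ∑²-red p m (toℕ ∘ onCycle₁) ⟨
      ∑² (p * m) (λ P → toℕ (onCycle₁ (red m P)))   ≡⟨ ∑²-cong (p * m) (λ _ P∈ → cong toℕ (onCycle-lift P∈)) ⟨
      ∑² (p * m) (toℕ ∘ onCycle₂)                   ≡⟨ Count₂.points-on-cycles ⟩
      (p * T) * ∑² (p * m) (toℕ ∘ isRep₂)           ≡⟨ cong ((p * T) *_) (count-points (p * m) isRep₂) ⟨
      (p * T) * N₂                                  ∎)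
      where
      open ≡-Reasoning
      m = p ^ k
      N₁ = N p {{p-nonZero pp}} a b T k
      N₂ = N p {{p-nonZero pp}} a b (p * T) (suc k)
      module Count₁ = CycleCount m a b T
      module Count₂ = CycleCount (p * m) a b (p * T)
      onCycle₁ = Count₁.onCycle
      isRep₁ = Count₁.isRep
      onCycle₂ = Count₂.onCycle
      isRep₂ = Count₂.isRep
      rearrange : ∀ p T n → (p * T) * (p * n) ≡ (p * p) * (T * n)
      rearrange = solve-∀

theorem5 : (p : ℕ) .{{_ : NonZero p}} → Prime p → (a b : ℤ) →
    (Tc : ℕ) → Tc ≥ 1 → (∀ e → IsValuation p Tc e → p < e) →
    (k : ℕ) → k ≥ 1 →
    p * N p a b Tc k ≡ N p a b (p * Tc) (suc k)
theorem5 p pp a b Tc Tc≥1 ν>p k _ with valuation>p⇒p^[1+p]∣ pp Tc≥1 ν>p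
... | divides s Tc≡s*p^[1+p] =
  subst (λ T → p * N p a b T k ≡ N p a b (p * T) (suc k)) (sym Tc≡) (cycle-count-lift pp a b 0<s k)
  where
  Tc≡ : Tc ≡ p * (p ^ p * s)
  Tc≡ = trans Tc≡s*p^[1+p] (trans (*-comm s (p ^ suc p)) (*-assoc p (p ^ p) s))
  0<s : 0 < s
  0<s = positive-factor (p * p ^ p) (subst (0 <_) (trans Tc≡ (sym (*-assoc p (p ^ p) s))) Tc≥1)
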